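{- For every integer $n\ge1$ there exists a homogeneous polynomial $f_n(Z,W)\in\mathbb{Z}[Z,W]$ of degree $s_n$ whose coefficient of $Z^{s_n}$ is $c_n$ and whose coefficient of $W^{s_n}$ is $d_n$, where $(c_n,d_n,s_n)=\left(n,(-1)^{\frac{n-1}{2}},\frac{n^2-1}{4}\right)$ if $n$ is odd and $(c_n,d_n,s_n)=\left(\frac n2,\frac n2,\frac{n^2-4}{4}\right)$ if $n$ is even, such that for every nonzero integer $D$, the $n$-th division polynomial $\psi_n\in\mathbb{Z}[x,y]$ of $E_D:y^2=x^3-Dx$ satisfies $\psi_n=f_n(x^2,D)$ if $n$ is odd and $\psi_n=2yf_n(x^2,D)$ if $n$ is even.
   Context: Division polynomials are the standard ones: $\psi_1=1$, $\psi_2=2y$, etc., defined by the usual recursions for a Weierstrass curve. -}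

module Defs where

open import Data.Nat as ℕ using (ℕ; zero; suc; _∸_; ⌊_/2⌋)
open import Data.Nat.DivMod as ND using ()
open import Data.Integer as ℤ using (ℤ; +_; -_)
open import Data.List using (List; []; _∷_)
open import Data.Vec using (Vec; lookup; tabulate; toList)
open import Data.Fin using (Fin; toℕ)
open import Data.Bool using (Bool; true; false; if_then_else_)
open import Relation.Binary.PropositionalEquality using (_≡_)

-- Univariate polynomials over ℤ in the variable x, as ascending
-- coefficient lists (trailing zeros allowed; equality is coefficientwise).

Poly : Set
Poly = List ℤ

coeff : Poly → ℕ → ℤ
coeff []      _       = + 0
coeff (a ∷ p) zero    = a
coeff (a ∷ p) (suc k) = coeff p k

infix 4 _≈ₚ_
_≈ₚ_ : Poly → Poly → Set
p ≈ₚ q = ∀ k → coeff p k ≡ coeff q k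

infixl 6 _+ₚ_ _-ₚ_
infixl 7 _*ₚ_

_+ₚ_ : Poly → Poly → Poly
[]      +ₚ q       = q
(a ∷ p) +ₚ []      = a ∷ p
(a ∷ p) +ₚ (b ∷ q) = (a ℤ.+ b) ∷ (p +ₚ q)

scaleₚ : ℤ → Poly → Poly
scaleₚ c []      = []
scaleₚ c (a ∷ p) = (c ℤ.* a) ∷ scaleₚ c p

_-ₚ_ : Poly → Poly → Poly
p -ₚ q = p +ₚ scaleₚ (- (+ 1)) q

_*ₚ_ : Poly → Poly → Poly
[]      *ₚ q = []
(a ∷ p) *ₚ q = scaleₚ a q +ₚ ((+ 0) ∷ (p *ₚ q))

constₚ : ℤ → Poly
constₚ c = c ∷ []

Xₚ : Poly
Xₚ = (+ 0) ∷ (+ 1) ∷ []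

_^ₚ_ : Poly → ℕ → Poly
p ^ₚ zero  = constₚ (+ 1)
p ^ₚ suc k = p *ₚ (p ^ₚ k)

sumₚ : List Poly → Poly
sumₚ []      = []
sumₚ (p ∷ ps) = p +ₚ sumₚ ps

-- coefficientwise integer halving (used only where division is exact)
halfₚ : Poly → Poly
halfₚ []      = []
halfₚ (a ∷ p) = (a ℤ./ (+ 2)) ∷ halfₚ p

-- Quotient of p by the monic cubic g = x³ + a x + b (synthetic division).
-- State: (quotient, r0, r1, r2) with p = g·quotient + r0 + r1 x + r2 x².
record DivState : Set where
  constructor ds
  field
    quo : Poly
    r0 r1 r2 : ℤ

divCubicSt : ℤ → ℤ → Poly → DivState
divCubicSt a b []       = ds [] (+ 0) (+ 0) (+ 0)
divCubicSt a b (p0 ∷ p) with divCubicSt a b p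
... | ds q s0 s1 s2 = ds (s2 ∷ q) (p0 ℤ.- b ℤ.* s2) (s0 ℤ.- a ℤ.* s2) s1

divCubic : ℤ → ℤ → Poly → Poly
divCubic a b p = DivState.quo (divCubicSt a b p)

-- The coordinate ring ℤ[x,y]/(y² - x³ - a x - b) of the short Weierstrass
-- curve y² = x³ + a x + b: every element is uniquely  re(x) + im(x)·y.

record CR : Set where
  constructor _⊕y_
  field
    re im : Poly
open CR public

infix 4 _≈ᶜ_
_≈ᶜ_ : CR → CR → Set
u ≈ᶜ v = (re u ≈ₚ re v) × (im u ≈ₚ im v)
  where open import Data.Product using (_×_)

cubic : ℤ → ℤ → Poly
cubic a b = b ∷ a ∷ (+ 0) ∷ (+ 1) ∷ []

module Curve (a b : ℤ) where

  infixl 6 _+ᶜ_ _-ᶜ_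
  infixl 7 _*ᶜ_

  _+ᶜ_ : CR → CR → CR
  (p ⊕y q) +ᶜ (r ⊕y s) = (p +ₚ r) ⊕y (q +ₚ s)

  _-ᶜ_ : CR → CR → CR
  (p ⊕y q) -ᶜ (r ⊕y s) = (p -ₚ r) ⊕y (q -ₚ s)

  -- (p + q y)(r + s y) = (p r + q s (x³+ax+b)) + (p s + q r) y
  _*ᶜ_ : CR → CR → CR
  (p ⊕y q) *ᶜ (r ⊕y s) = (p *ₚ r +ₚ q *ₚ s *ₚ cubic a b) ⊕y (p *ₚ s +ₚ q *ₚ r)

  sqᶜ cubeᶜ : CR → CR
  sqᶜ u = u *ᶜ u
  cubeᶜ u = u *ᶜ u *ᶜ u

  -- exact division by 2y:  (p + q y)/(2y) = q/2 + (p/(x³+ax+b))/2 · y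
  div2y : CR → CR
  div2y (p ⊕y q) = halfₚ q ⊕y halfₚ (divCubic a b p)

  isOdd : ℕ → Bool
  isOdd zero          = false
  isOdd (suc zero)    = true
  isOdd (suc (suc n)) = isOdd n

  ψ0 ψ1 ψ2 ψ3 ψ4 : CR
  ψ0 = [] ⊕y []
  ψ1 = constₚ (+ 1) ⊕y []
  ψ2 = [] ⊕y constₚ (+ 2)
  ψ3 = ((- (a ℤ.* a)) ∷ (+ 12 ℤ.* b) ∷ (+ 6 ℤ.* a) ∷ (+ 0) ∷ (+ 3) ∷ []) ⊕y []
  ψ4 = [] ⊕y scaleₚ (+ 4)
         ((- (+ 8 ℤ.* b ℤ.* b) ℤ.- a ℤ.* a ℤ.* a) ∷ (- (+ 4 ℤ.* a ℤ.* b))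
          ∷ (- (+ 5 ℤ.* a ℤ.* a)) ∷ (+ 20 ℤ.* b) ∷ (+ 5 ℤ.* a) ∷ (+ 0) ∷ (+ 1) ∷ [])

  -- fuel-indexed recursion; the fuel (≥ index) never runs out before
  -- reaching the base cases, since every recursive index is smaller.
  ψ′ : ℕ → ℕ → CR
  ψ′ zero    _ = ψ0
  ψ′ (suc f) 0 = ψ0
  ψ′ (suc f) 1 = ψ1
  ψ′ (suc f) 2 = ψ2
  ψ′ (suc f) 3 = ψ3
  ψ′ (suc f) 4 = ψ4
  ψ′ (suc f) n@(suc (suc (suc (suc (suc _))))) =
    if isOdd n
      then ψ′ f (m ℕ.+ 2) *ᶜ cubeᶜ (ψ′ f m) -ᶜ ψ′ f (m ∸ 1) *ᶜ cubeᶜ (ψ′ f (m ℕ.+ 1))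
      else div2y (ψ′ f m *ᶜ (ψ′ f (m ℕ.+ 2) *ᶜ sqᶜ (ψ′ f (m ∸ 1))
                              -ᶜ ψ′ f (m ∸ 2) *ᶜ sqᶜ (ψ′ f (m ℕ.+ 1))))
    where m = ⌊ n /2⌋

  ψ : ℕ → CR
  ψ n = ψ′ n n

divPoly : (D : ℤ) → ℕ → CR
divPoly D = Curve.ψ (- D) (+ 0)

isOdd : ℕ → Bool
isOdd = Curve.isOdd (+ 0) (+ 0)

-- Homogeneous polynomials of degree s in ℤ[Z,W]:
-- f : HomPoly s  represents  Σ_{i=0}^{s} f[i] · Z^(s-i) · W^i.

HomPoly : ℕ → Set
HomPoly s = Vec ℤ (suc s)

evalHom : (s : ℕ) → HomPoly s → Poly → Poly → Poly
evalHom s f Z W =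
  sumₚ (toList (tabulate {n = suc s}
    (λ i → constₚ (lookup f i) *ₚ (Z ^ₚ (s ∸ toℕ i)) *ₚ (W ^ₚ toℕ i))))

sₙ : ℕ → ℕ
sₙ n = if isOdd n then (n ℕ.* n ∸ 1) ND./ 4 else (n ℕ.* n ∸ 4) ND./ 4

cₙ : ℕ → ℤ
cₙ n = if isOdd n then + n else + (n ND./ 2)

dₙ : ℕ → ℤ
dₙ n = if isOdd n then (- (+ 1)) ℤ.^ ((n ∸ 1) ND./ 2) else + (n ND./ 2)

shape : (n : ℕ) (D : ℤ) → HomPoly (sₙ n) → CR
shape n D f =
  if isOdd n then evalHom (sₙ n) f (Xₚ ^ₚ 2) (constₚ D) ⊕y []
             else [] ⊕y scaleₚ (+ 2) (evalHom (sₙ n) f (Xₚ ^ₚ 2) (constₚ D))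

module Submission where

-- Write ψ_n for y² = x³ - D x as P(x) when n is odd and as 2y·P(x) when n
-- is even.  In the recursion for ψ_n, a product of two even-index factors
-- contributes (2y)² = 4 (x³ - D x), which the exact division by 2y in the
-- even step absorbs, and the odd step only ever meets (2y)⁴ = 16 x² (x² - D)².
-- Hence the P's are polynomials in x² and D, given by a recursion f_n on
-- homogeneous polynomials in Z, W with Z (Z - W)² standing for y⁴.
-- Strong induction on n, split by n mod 4, shows that the degrees of the f_n
-- and their values at (Z, W) = (1, 0) and (0, 1) (the coefficients of Z^s and
-- W^s) follow numerical recursions solved by s_n, c_n and d_n.

open import Defs
open import Level using (0ℓ)
open import Data.Nat as ℕ using (ℕ; zero; suc; _∸_; ⌊_/2⌋; _≤_; z≤n; s≤s)
import Data.Nat.Properties as ℕP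
import Data.Nat.DivMod as ℕD
import Data.Nat.Tactic.RingSolver as ℕSolver
open import Data.Integer as ℤ using (ℤ; +_; -_; -[1+_])
import Data.Integer.Properties as ℤP
import Data.Integer.DivMod as ℤD
import Data.Integer.Tactic.RingSolver as ℤSolver
open import Data.List as List using (List; []; _∷_; length)
open import Data.List.Relation.Binary.Pointwise using (Pointwise; []; _∷_)
open import Data.Vec as Vec using ([]; _∷_; lookup)
open import Data.Fin using (Fin; zero; suc; fromℕ; toℕ)
open import Data.Bool using (Bool; true; false; if_then_else_)
open import Data.Maybe using (Maybe; just; nothing)
open import Data.Product using (Σ; _×_; _,_; proj₁; proj₂)
open import Data.Empty using (⊥-elim)
open import Relation.Nullary using (yes; no)
open import Relation.Binary.PropositionalEquality as Eq
  using (_≡_; _≢_; refl; sym; trans; cong; cong₂; subst; subst₂)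
open import Function using (_∘_)
open import Algebra using (CommutativeRing; RawRing)
open import Algebra.Structures using (IsCommutativeRing)
import Algebra.Solver.Ring
import Algebra.Solver.Ring.AlmostCommutativeRing as ACR
import Relation.Binary.Reasoning.Setoid as SetoidReasoning

-- The polynomial ring ℤ[x]

coeff-+ₚ : ∀ p q k → coeff (p +ₚ q) k ≡ coeff p k ℤ.+ coeff q k
coeff-+ₚ []      q       k       = sym (ℤP.+-identityˡ _)
coeff-+ₚ (a ∷ p) []      k       = sym (ℤP.+-identityʳ _)
coeff-+ₚ (a ∷ p) (b ∷ q) zero    = refl
coeff-+ₚ (a ∷ p) (b ∷ q) (suc k) = coeff-+ₚ p q k

coeff-scaleₚ : ∀ c p k → coeff (scaleₚ c p) k ≡ c ℤ.* coeff p k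
coeff-scaleₚ c []      k       = sym (ℤP.*-zeroʳ c)
coeff-scaleₚ c (a ∷ p) zero    = refl
coeff-scaleₚ c (a ∷ p) (suc k) = coeff-scaleₚ c p k

-- _≈ₚ_ wrapped in a record, so that the two polynomials can be inferred
-- from a proof (a Π-type would be unfolded and lose them).
infix 4 _≋_
record _≋_ (p q : Poly) : Set where
  constructor ⟪_⟫
  field un : p ≈ₚ q
open _≋_ public

≋-refl : ∀ {p} → p ≋ p
≋-refl = ⟪ (λ k → refl) ⟫

≋-sym : ∀ {p q} → p ≋ q → q ≋ p
≋-sym ⟪ h ⟫ = ⟪ (λ k → sym (h k)) ⟫

≋-trans : ∀ {p q r} → p ≋ q → q ≋ r → p ≋ r
≋-trans ⟪ h ⟫ ⟪ g ⟫ = ⟪ (λ k → trans (h k) (g k)) ⟫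

≡⇒≋ : ∀ {p q} → p ≡ q → p ≋ q
≡⇒≋ refl = ≋-refl

∷-cong : ∀ {a b p q} → a ≡ b → p ≋ q → (a ∷ p) ≋ (b ∷ q)
∷-cong e ⟪ h ⟫ = ⟪ (λ { zero → e ; (suc k) → h k }) ⟫

∷-headᵉ : ∀ {a b p q} → (a ∷ p) ≋ (b ∷ q) → a ≡ b
∷-headᵉ ⟪ h ⟫ = h zero

∷-tailᵉ : ∀ {a b p q} → (a ∷ p) ≋ (b ∷ q) → p ≋ q
∷-tailᵉ ⟪ h ⟫ = ⟪ (λ k → h (suc k)) ⟫

+ₚ-cong : ∀ {p p′ q q′} → p ≋ p′ → q ≋ q′ → p +ₚ q ≋ p′ +ₚ q′
+ₚ-cong {p} {p′} {q} {q′} ⟪ h ⟫ ⟪ g ⟫ = ⟪ (λ k →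
  trans (coeff-+ₚ p q k) (trans (cong₂ ℤ._+_ (h k) (g k)) (sym (coeff-+ₚ p′ q′ k)))) ⟫

+ₚ-congˡ : ∀ p {q q′} → q ≋ q′ → p +ₚ q ≋ p +ₚ q′
+ₚ-congˡ p = +ₚ-cong (≋-refl {p})

+ₚ-congʳ : ∀ q {p p′} → p ≋ p′ → p +ₚ q ≋ p′ +ₚ q
+ₚ-congʳ q h = +ₚ-cong h (≋-refl {q})

scaleₚ-cong : ∀ {c d p q} → c ≡ d → p ≋ q → scaleₚ c p ≋ scaleₚ d q
scaleₚ-cong {c} {d} {p} {q} e ⟪ h ⟫ = ⟪ (λ k →
  trans (coeff-scaleₚ c p k) (trans (cong₂ ℤ._*_ e (h k)) (sym (coeff-scaleₚ d q k)))) ⟫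

+ₚ-assoc : ∀ p q r → (p +ₚ q) +ₚ r ≋ p +ₚ (q +ₚ r)
+ₚ-assoc p q r = ⟪ (λ k → begin
  coeff ((p +ₚ q) +ₚ r) k                   ≡⟨ coeff-+ₚ (p +ₚ q) r k ⟩
  coeff (p +ₚ q) k ℤ.+ coeff r k            ≡⟨ cong (λ x → x ℤ.+ coeff r k) (coeff-+ₚ p q k) ⟩
  coeff p k ℤ.+ coeff q k ℤ.+ coeff r k     ≡⟨ ℤP.+-assoc (coeff p k) _ _ ⟩
  coeff p k ℤ.+ (coeff q k ℤ.+ coeff r k)   ≡⟨ cong (λ x → coeff p k ℤ.+ x) (coeff-+ₚ q r k) ⟨
  coeff p k ℤ.+ coeff (q +ₚ r) k            ≡⟨ coeff-+ₚ p (q +ₚ r) k ⟨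
  coeff (p +ₚ (q +ₚ r)) k                   ∎) ⟫
  where open Eq.≡-Reasoning

+ₚ-comm : ∀ p q → p +ₚ q ≋ q +ₚ p
+ₚ-comm p q = ⟪ (λ k → begin
  coeff (p +ₚ q) k          ≡⟨ coeff-+ₚ p q k ⟩
  coeff p k ℤ.+ coeff q k   ≡⟨ ℤP.+-comm (coeff p k) _ ⟩
  coeff q k ℤ.+ coeff p k   ≡⟨ coeff-+ₚ q p k ⟨
  coeff (q +ₚ p) k          ∎) ⟫
  where open Eq.≡-Reasoning

+ₚ-identityʳ : ∀ p → p +ₚ [] ≋ p
+ₚ-identityʳ p = ⟪ (λ k → trans (coeff-+ₚ p [] k) (ℤP.+-identityʳ _)) ⟫

+ₚ-interchange : ∀ w x y z → (w +ₚ x) +ₚ (y +ₚ z) ≋ (w +ₚ y) +ₚ (x +ₚ z)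
+ₚ-interchange w x y z = ⟪ (λ k →
  trans (coeff-+ₚ (w +ₚ x) (y +ₚ z) k)
  (trans (cong₂ ℤ._+_ (coeff-+ₚ w x k) (coeff-+ₚ y z k))
  (trans (interchange (coeff w k) (coeff x k) (coeff y k) (coeff z k))
  (sym (trans (coeff-+ₚ (w +ₚ y) (x +ₚ z) k) (cong₂ ℤ._+_ (coeff-+ₚ w y k) (coeff-+ₚ x z k))))))) ⟫
  where
  interchange : ∀ a b c d → (a ℤ.+ b) ℤ.+ (c ℤ.+ d) ≡ (a ℤ.+ c) ℤ.+ (b ℤ.+ d)
  interchange = ℤSolver.solve-∀

negₚ : Poly → Poly
negₚ = scaleₚ (- (+ 1))

negₚ-cong : ∀ {p q} → p ≋ q → negₚ p ≋ negₚ q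
negₚ-cong = scaleₚ-cong refl

+ₚ-inverseˡ : ∀ p → negₚ p +ₚ p ≋ []
+ₚ-inverseˡ p = ⟪ (λ k →
  trans (coeff-+ₚ (negₚ p) p k)
  (trans (cong (λ x → x ℤ.+ coeff p k) (coeff-scaleₚ (- (+ 1)) p k)) (cancel (coeff p k)))) ⟫
  where
  cancel : ∀ x → (- (+ 1)) ℤ.* x ℤ.+ x ≡ + 0
  cancel = ℤSolver.solve-∀

+ₚ-inverseʳ : ∀ p → p +ₚ negₚ p ≋ []
+ₚ-inverseʳ p = ≋-trans (+ₚ-comm p (negₚ p)) (+ₚ-inverseˡ p)

scaleₚ-distribˡ : ∀ c p q → scaleₚ c (p +ₚ q) ≋ scaleₚ c p +ₚ scaleₚ c q
scaleₚ-distribˡ c p q = ⟪ (λ k →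
  trans (coeff-scaleₚ c (p +ₚ q) k)
  (trans (cong (c ℤ.*_) (coeff-+ₚ p q k))
  (trans (ℤP.*-distribˡ-+ c _ _)
  (sym (trans (coeff-+ₚ (scaleₚ c p) (scaleₚ c q) k)
              (cong₂ ℤ._+_ (coeff-scaleₚ c p k) (coeff-scaleₚ c q k))))))) ⟫

scaleₚ-distribʳ : ∀ a b q → scaleₚ (a ℤ.+ b) q ≋ scaleₚ a q +ₚ scaleₚ b q
scaleₚ-distribʳ a b q = ⟪ (λ k →
  trans (coeff-scaleₚ (a ℤ.+ b) q k)
  (trans (ℤP.*-distribʳ-+ _ a b)
  (sym (trans (coeff-+ₚ (scaleₚ a q) (scaleₚ b q) k)
              (cong₂ ℤ._+_ (coeff-scaleₚ a q k) (coeff-scaleₚ b q k)))))) ⟫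

scaleₚ-scaleₚ : ∀ a c q → scaleₚ a (scaleₚ c q) ≋ scaleₚ (a ℤ.* c) q
scaleₚ-scaleₚ a c q = ⟪ (λ k →
  trans (coeff-scaleₚ a (scaleₚ c q) k)
  (trans (cong (a ℤ.*_) (coeff-scaleₚ c q k))
  (trans (sym (ℤP.*-assoc a c _)) (sym (coeff-scaleₚ (a ℤ.* c) q k))))) ⟫

scaleₚ-zero : ∀ p → scaleₚ (+ 0) p ≋ []
scaleₚ-zero p = ⟪ (λ k → trans (coeff-scaleₚ (+ 0) p k) (ℤP.*-zeroˡ (coeff p k))) ⟫

*ₚ-zeroˡ : ∀ {p} q → p ≋ [] → p *ₚ q ≋ []
*ₚ-zeroˡ {[]}    q h = ≋-refl
*ₚ-zeroˡ {a ∷ p} q ⟪ h ⟫ = ≋-trans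
  (+ₚ-cong (≋-trans (scaleₚ-cong (h zero) ≋-refl) (scaleₚ-zero q))
           (∷-cong refl (*ₚ-zeroˡ {p} q ⟪ (λ k → h (suc k)) ⟫)))
  ⟪ (λ { zero → refl ; (suc k) → refl }) ⟫

*ₚ-zeroʳ : ∀ p → p *ₚ [] ≋ []
*ₚ-zeroʳ []      = ≋-refl
*ₚ-zeroʳ (a ∷ p) = ≋-trans (∷-cong refl (*ₚ-zeroʳ p)) ⟪ (λ { zero → refl ; (suc k) → refl }) ⟫

*ₚ-congˡ : ∀ {p p′} q → p ≋ p′ → p *ₚ q ≋ p′ *ₚ q
*ₚ-congˡ {[]}    {[]}     q h = ≋-refl
*ₚ-congˡ {[]}    {b ∷ p′} q h = ≋-sym (*ₚ-zeroˡ q (≋-sym h))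
*ₚ-congˡ {a ∷ p} {[]}     q h = *ₚ-zeroˡ q h
*ₚ-congˡ {a ∷ p} {b ∷ p′} q h =
  +ₚ-cong (scaleₚ-cong (∷-headᵉ h) ≋-refl) (∷-cong refl (*ₚ-congˡ q (∷-tailᵉ h)))

*ₚ-congʳ : ∀ p {q q′} → q ≋ q′ → p *ₚ q ≋ p *ₚ q′
*ₚ-congʳ []      h = ≋-refl
*ₚ-congʳ (a ∷ p) h = +ₚ-cong (scaleₚ-cong refl h) (∷-cong refl (*ₚ-congʳ p h))

*ₚ-cong : ∀ {p p′ q q′} → p ≋ p′ → q ≋ q′ → p *ₚ q ≋ p′ *ₚ q′
*ₚ-cong {p′ = p′} {q = q} h g = ≋-trans (*ₚ-congˡ q h) (*ₚ-congʳ p′ g)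

*ₚ-distribʳ : ∀ p p′ q → (p +ₚ p′) *ₚ q ≋ p *ₚ q +ₚ p′ *ₚ q
*ₚ-distribʳ []      p′       q = ≋-refl
*ₚ-distribʳ (a ∷ p) []       q = ≋-sym (+ₚ-identityʳ _)
*ₚ-distribʳ (a ∷ p) (b ∷ p′) q = ≋-trans
  (+ₚ-cong (scaleₚ-distribʳ a b q) (∷-cong refl (*ₚ-distribʳ p p′ q)))
  (+ₚ-interchange (scaleₚ a q) (scaleₚ b q) (+ 0 ∷ (p *ₚ q)) (+ 0 ∷ (p′ *ₚ q)))

*ₚ-distribˡ : ∀ p q q′ → p *ₚ (q +ₚ q′) ≋ p *ₚ q +ₚ p *ₚ q′
*ₚ-distribˡ []      q q′ = ≋-refl
*ₚ-distribˡ (a ∷ p) q q′ = ≋-trans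
  (+ₚ-cong (scaleₚ-distribˡ a q q′) (∷-cong refl (*ₚ-distribˡ p q q′)))
  (+ₚ-interchange (scaleₚ a q) (scaleₚ a q′) (+ 0 ∷ (p *ₚ q)) (+ 0 ∷ (p *ₚ q′)))

scaleₚ-*ₚˡ : ∀ c p q → scaleₚ c (p *ₚ q) ≋ scaleₚ c p *ₚ q
scaleₚ-*ₚˡ c []      q = ≋-refl
scaleₚ-*ₚˡ c (a ∷ p) q = ≋-trans (scaleₚ-distribˡ c (scaleₚ a q) (+ 0 ∷ (p *ₚ q)))
  (+ₚ-cong (scaleₚ-scaleₚ c a q) (∷-cong (ℤP.*-zeroʳ c) (scaleₚ-*ₚˡ c p q)))

shiftₚ-*ₚ : ∀ p q → (+ 0 ∷ p) *ₚ q ≋ + 0 ∷ (p *ₚ q)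
shiftₚ-*ₚ p q = ≋-trans (+ₚ-cong (scaleₚ-zero q) ≋-refl) ≋-refl

*ₚ-assoc : ∀ p q r → (p *ₚ q) *ₚ r ≋ p *ₚ (q *ₚ r)
*ₚ-assoc []      q r = ≋-refl
*ₚ-assoc (a ∷ p) q r = ≋-trans (*ₚ-distribʳ (scaleₚ a q) (+ 0 ∷ (p *ₚ q)) r)
  (+ₚ-cong (≋-sym (scaleₚ-*ₚˡ a q r))
           (≋-trans (shiftₚ-*ₚ (p *ₚ q) r) (∷-cong refl (*ₚ-assoc p q r))))

*ₚ-∷ʳ : ∀ q a p → q *ₚ (a ∷ p) ≋ scaleₚ a q +ₚ (+ 0 ∷ (q *ₚ p))
*ₚ-∷ʳ []      a p = ⟪ (λ { zero → refl ; (suc k) → refl }) ⟫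
*ₚ-∷ʳ (b ∷ q) a p = ∷-cong (trans (ℤP.+-identityʳ _) (trans (ℤP.*-comm b a) (sym (ℤP.+-identityʳ _))))
  (≋-trans (+ₚ-cong ≋-refl (*ₚ-∷ʳ q a p))
    (≋-trans (≋-sym (+ₚ-assoc (scaleₚ b p) (scaleₚ a q) _))
    (≋-trans (+ₚ-cong (+ₚ-comm (scaleₚ b p) (scaleₚ a q)) ≋-refl)
             (+ₚ-assoc (scaleₚ a q) (scaleₚ b p) _))))

*ₚ-comm : ∀ p q → p *ₚ q ≋ q *ₚ p
*ₚ-comm []      q = ≋-sym (*ₚ-zeroʳ q)
*ₚ-comm (a ∷ p) q = ≋-trans (+ₚ-cong ≋-refl (∷-cong refl (*ₚ-comm p q))) (≋-sym (*ₚ-∷ʳ q a p))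

*ₚ-identityˡ : ∀ q → constₚ (+ 1) *ₚ q ≋ q
*ₚ-identityˡ q = ≋-trans (+ₚ-cong (scaleₚ-one q) ≋-refl) (pad q)
  where
  scaleₚ-one : ∀ q → scaleₚ (+ 1) q ≋ q
  scaleₚ-one q = ⟪ (λ k → trans (coeff-scaleₚ (+ 1) q k) (ℤP.*-identityˡ _)) ⟫
  pad : ∀ q → q +ₚ (+ 0 ∷ []) ≋ q
  pad q = ⟪ (λ k → trans (coeff-+ₚ q (+ 0 ∷ []) k) (trans (cong (λ x → coeff q k ℤ.+ x) (zero-coeff k)) (ℤP.+-identityʳ _))) ⟫
    where
    zero-coeff : ∀ k → coeff (+ 0 ∷ []) k ≡ + 0
    zero-coeff zero    = refl
    zero-coeff (suc k) = refl

polyIsCommutativeRing : IsCommutativeRing _≋_ _+ₚ_ _*ₚ_ negₚ [] (constₚ (+ 1))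
polyIsCommutativeRing = record
  { isRing = record
    { +-isAbelianGroup = record
      { isGroup = record
        { isMonoid = record
          { isSemigroup = record
            { isMagma = record
              { isEquivalence = record { refl = ≋-refl ; sym = ≋-sym ; trans = ≋-trans }
              ; ∙-cong = +ₚ-cong }
            ; assoc = +ₚ-assoc }
          ; identity = (λ p → ≋-refl) , +ₚ-identityʳ }
        ; inverse = +ₚ-inverseˡ , +ₚ-inverseʳ
        ; ⁻¹-cong = negₚ-cong }
      ; comm = +ₚ-comm }
    ; *-cong = *ₚ-cong
    ; *-assoc = *ₚ-assoc
    ; *-identity = *ₚ-identityˡ , (λ q → ≋-trans (*ₚ-comm q (constₚ (+ 1))) (*ₚ-identityˡ q))
    ; distrib = *ₚ-distribˡ , (λ x y z → *ₚ-distribʳ y z x) }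
  ; *-comm = *ₚ-comm }

ℤ[x] : CommutativeRing 0ℓ 0ℓ
ℤ[x] = record { isCommutativeRing = polyIsCommutativeRing }

ℤ-rawRing : RawRing 0ℓ 0ℓ
ℤ-rawRing = CommutativeRing.rawRing ℤP.+-*-commutativeRing

module ℤConstantsSolver (R : CommutativeRing 0ℓ 0ℓ)
  (ι : ℤ-rawRing ACR.-Raw-AlmostCommutative⟶ ACR.fromCommutativeRing R) where
  open CommutativeRing R using (_≈_) renaming (refl to ≈-refl)
  open ACR._-Raw-AlmostCommutative⟶_ ι using (⟦_⟧)

  ≟-ι : ∀ a b → Maybe (⟦ a ⟧ ≈ ⟦ b ⟧)
  ≟-ι a b with a ℤ.≟ b
  ... | yes refl = just ≈-refl
  ... | no _     = nothing

  open Algebra.Solver.Ring ℤ-rawRing (ACR.fromCommutativeRing R) ι ≟-ι public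

constₚ-morphism : ℤ-rawRing ACR.-Raw-AlmostCommutative⟶ ACR.fromCommutativeRing ℤ[x]
constₚ-morphism = record
  { ⟦_⟧    = constₚ
  ; +-homo = λ a b → ≋-refl
  ; *-homo = λ a b → ∷-cong (sym (ℤP.+-identityʳ _)) ≋-refl
  ; -‿homo = λ a → ∷-cong (sym (ℤP.-1*i≡-i a)) ≋-refl
  ; 0-homo = ⟪ (λ { zero → refl ; (suc k) → refl }) ⟫
  ; 1-homo = ≋-refl }

ℤ-identity-morphism : ℤ-rawRing ACR.-Raw-AlmostCommutative⟶ ACR.fromCommutativeRing ℤP.+-*-commutativeRing
ℤ-identity-morphism = record
  { ⟦_⟧    = λ x → x
  ; +-homo = λ a b → refl
  ; *-homo = λ a b → refl
  ; -‿homo = λ a → refl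
  ; 0-homo = refl
  ; 1-homo = refl }

module PolySolver = ℤConstantsSolver ℤ[x] constₚ-morphism
open ACR._-Raw-AlmostCommutative⟶_ constₚ-morphism using ()
  renaming (+-homo to constₚ-+; *-homo to constₚ-*; -‿homo to constₚ-neg)
module ≋-Reasoning = SetoidReasoning (CommutativeRing.setoid ℤ[x])

Xₚ-*ₚ : ∀ p → Xₚ *ₚ p ≋ + 0 ∷ p
Xₚ-*ₚ p = +ₚ-cong (scaleₚ-zero p) (∷-cong refl (*ₚ-identityˡ p))

∷-horner : ∀ a p → a ∷ p ≋ constₚ a +ₚ Xₚ *ₚ p
∷-horner a p = ≋-sym (≋-trans (+ₚ-congˡ (constₚ a) (Xₚ-*ₚ p)) (∷-cong (ℤP.+-identityʳ a) ≋-refl))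

scaleₚ-as-*ₚ : ∀ k p → scaleₚ k p ≋ constₚ k *ₚ p
scaleₚ-as-*ₚ k p = ≋-sym (≋-trans (+ₚ-congˡ (scaleₚ k p) ⟪ (λ { zero → refl ; (suc j) → refl }) ⟫) (+ₚ-identityʳ (scaleₚ k p)))

constₚ-- : ∀ x y → constₚ (x ℤ.- y) ≋ constₚ x -ₚ constₚ y
constₚ-- x y = ≋-trans (constₚ-+ x (- y)) (+ₚ-congˡ (constₚ x) (constₚ-neg y))

hornerᴾ : List Poly → Poly
hornerᴾ []           = []
hornerᴾ (P ∷ [])     = P
hornerᴾ (P ∷ Q ∷ Ps) = P +ₚ Xₚ *ₚ hornerᴾ (Q ∷ Ps)

≋-hornerᴾ : ∀ p → p ≋ hornerᴾ (List.map constₚ p)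
≋-hornerᴾ []          = ≋-refl
≋-hornerᴾ (a ∷ [])    = ≋-refl
≋-hornerᴾ (a ∷ b ∷ p) = ≋-trans (∷-horner a (b ∷ p)) (+ₚ-congˡ (constₚ a) (*ₚ-congʳ Xₚ (≋-hornerᴾ (b ∷ p))))

hornerᴾ-cong : ∀ {Ps Qs} → Pointwise _≋_ Ps Qs → hornerᴾ Ps ≋ hornerᴾ Qs
hornerᴾ-cong []            = ≋-refl
hornerᴾ-cong (e ∷ [])      = e
hornerᴾ-cong (e ∷ e′ ∷ es) = +ₚ-cong e (*ₚ-congʳ Xₚ (hornerᴾ-cong (e′ ∷ es)))

coeff-halfₚ : ∀ p k → coeff (halfₚ p) k ≡ coeff p k ℤ./ + 2
coeff-halfₚ []      k       = refl
coeff-halfₚ (a ∷ p) zero    = refl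
coeff-halfₚ (a ∷ p) (suc k) = coeff-halfₚ p k

halfₚ-cong : ∀ {p q} → p ≋ q → halfₚ p ≋ halfₚ q
halfₚ-cong {p} {q} ⟪ h ⟫ = ⟪ (λ k →
  trans (coeff-halfₚ p k) (trans (cong (ℤ._/ + 2) (h k)) (sym (coeff-halfₚ q k)))) ⟫

2*z/2≡z : ∀ z → (+ 2 ℤ.* z) ℤ./ + 2 ≡ z
2*z/2≡z (+ k) = trans (ℤD.div-pos-is-/ℕ (+ 2 ℤ.* + k) 2)
  (trans (cong (ℤ._/ℕ 2) (sym (ℤP.pos-* 2 k))) (cong +_ (trans (cong (ℕD._/ 2) (ℕP.*-comm 2 k)) (ℕD.m*n/n≡m k 2))))
2*z/2≡z -[1+ k ] = trans (ℤD.div-pos-is-/ℕ (+ 2 ℤ.* -[1+ k ]) 2) (neg-/ℕ2 (k ℕ.+ suc (k ℕ.+ 0)) k (double k))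
  where
  double : ∀ k → suc (k ℕ.+ suc (k ℕ.+ 0)) ≡ suc k ℕ.* 2
  double = ℕSolver.solve-∀
  neg-/ℕ2 : ∀ n m → suc n ≡ suc m ℕ.* 2 → -[1+ n ] ℤ./ℕ 2 ≡ -[1+ m ]
  neg-/ℕ2 n m e with suc n ℕD.% 2 in eq
  ... | zero  = cong (λ x → - (+ x)) (trans (cong (ℕD._/ 2) e) (ℕD.m*n/n≡m (suc m) 2))
  ... | suc r with () ← trans (sym eq) (trans (cong (ℕD._% 2) e) (ℕD.m*n%n≡0 (suc m) 2))

halfₚ-double : ∀ p → halfₚ (scaleₚ (+ 2) p) ≋ p
halfₚ-double p = ⟪ (λ k → trans (coeff-halfₚ (scaleₚ (+ 2) p) k)
  (trans (cong (ℤ._/ + 2) (coeff-scaleₚ (+ 2) p k)) (2*z/2≡z (coeff p k)))) ⟫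

-- Division by the monic cubic x³ + a x + b

module CubicDivision (a b : ℤ) where

  cubic-horner : cubic a b ≋ constₚ b +ₚ Xₚ *ₚ (constₚ a +ₚ Xₚ *ₚ (constₚ (+ 0) +ₚ Xₚ *ₚ constₚ (+ 1)))
  cubic-horner = ≋-hornerᴾ (cubic a b)

  remainder : DivState → Poly
  remainder (ds q r₀ r₁ r₂) = r₀ ∷ r₁ ∷ r₂ ∷ []

  divCubicSt-correct : ∀ p → p ≋ cubic a b *ₚ DivState.quo (divCubicSt a b p) +ₚ remainder (divCubicSt a b p)
  divCubicSt-correct [] = ≋-sym (≋-trans (+ₚ-congʳ (+ 0 ∷ + 0 ∷ + 0 ∷ []) (*ₚ-zeroʳ (cubic a b)))
    ⟪ (λ { zero → refl ; (suc zero) → refl ; (suc (suc zero)) → refl ; (suc (suc (suc k))) → refl }) ⟫)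
  divCubicSt-correct (p₀ ∷ p) with divCubicSt a b p | divCubicSt-correct p
  ... | ds q s₀ s₁ s₂ | ih = begin
    p₀ ∷ p                                             ≈⟨ ∷-horner p₀ p ⟩
    P₀ +ₚ Xₚ *ₚ p                                      ≈⟨ +ₚ-congˡ P₀ (*ₚ-congʳ Xₚ (≋-trans ih
                                                            (+ₚ-cong (*ₚ-congˡ q cubic-horner) (≋-hornerᴾ (s₀ ∷ s₁ ∷ s₂ ∷ []))))) ⟩
    P₀ +ₚ Xₚ *ₚ (G *ₚ q +ₚ (S₀ +ₚ Xₚ *ₚ (S₁ +ₚ Xₚ *ₚ S₂)))
      ≈⟨ solve 8 (λ P₀ B A S₀ S₁ S₂ X Q →
           P₀ :+ X :* ((B :+ X :* (A :+ X :* (con (+ 0) :+ X :* con (+ 1)))) :* Q :+ (S₀ :+ X :* (S₁ :+ X :* S₂)))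
        := (B :+ X :* (A :+ X :* (con (+ 0) :+ X :* con (+ 1)))) :* (S₂ :+ X :* Q)
           :+ ((P₀ :- B :* S₂) :+ X :* ((S₀ :- A :* S₂) :+ X :* S₁)))
         ≋-refl P₀ B A S₀ S₁ S₂ Xₚ q ⟩
    G *ₚ (S₂ +ₚ Xₚ *ₚ q) +ₚ ((P₀ -ₚ B *ₚ S₂) +ₚ Xₚ *ₚ ((S₀ -ₚ A *ₚ S₂) +ₚ Xₚ *ₚ S₁))
      ≈⟨ +ₚ-cong (*ₚ-cong cubic-horner (∷-horner s₂ q)) (≋-trans
           (≋-hornerᴾ ((p₀ ℤ.- b ℤ.* s₂) ∷ (s₀ ℤ.- a ℤ.* s₂) ∷ s₁ ∷ []))
           (+ₚ-cong (const-- p₀ b) (*ₚ-congʳ Xₚ (+ₚ-congʳ (Xₚ *ₚ S₁) (const-- s₀ a))))) ⟨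
    cubic a b *ₚ (s₂ ∷ q) +ₚ ((p₀ ℤ.- b ℤ.* s₂) ∷ (s₀ ℤ.- a ℤ.* s₂) ∷ s₁ ∷ []) ∎
    where
    open ≋-Reasoning
    open PolySolver
    P₀ = constₚ p₀ ; B = constₚ b ; A = constₚ a
    S₀ = constₚ s₀ ; S₁ = constₚ s₁ ; S₂ = constₚ s₂
    G = B +ₚ Xₚ *ₚ (A +ₚ Xₚ *ₚ (constₚ (+ 0) +ₚ Xₚ *ₚ constₚ (+ 1)))
    const-- : ∀ u v → constₚ (u ℤ.- v ℤ.* s₂) ≋ constₚ u -ₚ constₚ v *ₚ S₂
    const-- u v = ≋-trans (constₚ-- u (v ℤ.* s₂)) (+ₚ-congˡ (constₚ u) (negₚ-cong (constₚ-* v s₂)))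

  coeff-beyond-length : ∀ q j → length q ≤ j → coeff q j ≡ + 0
  coeff-beyond-length []      j       le        = refl
  coeff-beyond-length (x ∷ q) (suc j) (s≤s le) = coeff-beyond-length q j le

  coeff-cubic-*ₚ : ∀ q j → coeff (cubic a b *ₚ q) (3 ℕ.+ j)
    ≡ b ℤ.* coeff q (3 ℕ.+ j) ℤ.+ (a ℤ.* coeff q (2 ℕ.+ j) ℤ.+ (+ 0 ℤ.* coeff q (1 ℕ.+ j)
      ℤ.+ (+ 1 ℤ.* coeff q j ℤ.+ coeff (+ 0 ∷ ([] *ₚ q)) j)))
  coeff-cubic-*ₚ q j
    rewrite coeff-+ₚ (scaleₚ b q) (+ 0 ∷ ((a ∷ + 0 ∷ + 1 ∷ []) *ₚ q)) (3 ℕ.+ j)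
          | coeff-scaleₚ b q (3 ℕ.+ j)
          | coeff-+ₚ (scaleₚ a q) (+ 0 ∷ ((+ 0 ∷ + 1 ∷ []) *ₚ q)) (2 ℕ.+ j)
          | coeff-scaleₚ a q (2 ℕ.+ j)
          | coeff-+ₚ (scaleₚ (+ 0) q) (+ 0 ∷ ((+ 1 ∷ []) *ₚ q)) (1 ℕ.+ j)
          | coeff-scaleₚ (+ 0) q (1 ℕ.+ j)
          | coeff-+ₚ (scaleₚ (+ 1) q) (+ 0 ∷ ([] *ₚ q)) j
          | coeff-scaleₚ (+ 1) q j = refl

  -- The coefficients of a quotient q with zero remainder satisfy a
  -- downward recurrence q_j = -(b q_{j+3} + a q_{j+2}), and vanish
  -- beyond the length of q.
  quotient≋0 : ∀ q r₀ r₁ r₂ → cubic a b *ₚ q +ₚ (r₀ ∷ r₁ ∷ r₂ ∷ []) ≋ [] → q ≋ []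
  quotient≋0 q r₀ r₁ r₂ ⟪ h ⟫ = ⟪ (λ j → vanish (length q) j (ℕP.m≤n+m (length q) j)) ⟫
    where
    recurrence : ∀ j → coeff q j ≡ - (b ℤ.* coeff q (3 ℕ.+ j) ℤ.+ a ℤ.* coeff q (2 ℕ.+ j))
    recurrence j = begin
      coeff q j                                 ≡⟨ solve-for-q₀ a b _ (coeff q (1 ℕ.+ j)) _ _ (low-term j) ⟩
      - (b ℤ.* q₃ ℤ.+ a ℤ.* q₂) ℤ.+ (top ℤ.+ + 0)  ≡⟨ cong (λ t → - (b ℤ.* q₃ ℤ.+ a ℤ.* q₂) ℤ.+ t) top≡0 ⟩
      - (b ℤ.* q₃ ℤ.+ a ℤ.* q₂) ℤ.+ + 0           ≡⟨ ℤP.+-identityʳ _ ⟩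
      - (b ℤ.* q₃ ℤ.+ a ℤ.* q₂)                   ∎
      where
      open Eq.≡-Reasoning
      q₃ = coeff q (3 ℕ.+ j)
      q₂ = coeff q (2 ℕ.+ j)
      top = b ℤ.* q₃ ℤ.+ (a ℤ.* q₂ ℤ.+ (+ 0 ℤ.* coeff q (1 ℕ.+ j) ℤ.+ (+ 1 ℤ.* coeff q j ℤ.+ coeff (+ 0 ∷ ([] *ₚ q)) j)))
      top≡0 : top ℤ.+ + 0 ≡ + 0
      top≡0 = trans (sym (trans (coeff-+ₚ (cubic a b *ₚ q) (r₀ ∷ r₁ ∷ r₂ ∷ []) (3 ℕ.+ j))
                                (cong (λ t → t ℤ.+ + 0) (coeff-cubic-*ₚ q j))))
                    (h (3 ℕ.+ j))
      low-term : ∀ j → coeff (+ 0 ∷ ([] *ₚ q)) j ≡ + 0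
      low-term zero    = refl
      low-term (suc j) = refl
      solve-for-q₀ : ∀ a b q₀ q₁ q₂ q₃ {e} → e ≡ + 0 →
        q₀ ≡ - (b ℤ.* q₃ ℤ.+ a ℤ.* q₂) ℤ.+ ((b ℤ.* q₃ ℤ.+ (a ℤ.* q₂ ℤ.+ (+ 0 ℤ.* q₁ ℤ.+ (+ 1 ℤ.* q₀ ℤ.+ e)))) ℤ.+ + 0)
      solve-for-q₀ a b q₀ q₁ q₂ q₃ refl = lemma a b q₀ q₁ q₂ q₃
        where
        lemma : ∀ a b q₀ q₁ q₂ q₃ →
          q₀ ≡ - (b ℤ.* q₃ ℤ.+ a ℤ.* q₂) ℤ.+ ((b ℤ.* q₃ ℤ.+ (a ℤ.* q₂ ℤ.+ (+ 0 ℤ.* q₁ ℤ.+ (+ 1 ℤ.* q₀ ℤ.+ + 0)))) ℤ.+ + 0)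
        lemma = ℤSolver.solve-∀
    vanish : ∀ d j → length q ≤ j ℕ.+ d → coeff q j ≡ + 0
    vanish zero    j le = coeff-beyond-length q j (subst (length q ≤_) (ℕP.+-identityʳ j) le)
    vanish (suc d) j le = trans (recurrence j)
      (trans (cong₂ (λ u v → - (b ℤ.* u ℤ.+ a ℤ.* v)) (vanish d (3 ℕ.+ j) (raise 2)) (vanish d (2 ℕ.+ j) (raise 1)))
             (zero-combination a b))
      where
      raise : ∀ k → length q ≤ k ℕ.+ suc (j ℕ.+ d)
      raise k = ℕP.≤-trans le (ℕP.≤-trans (ℕP.≤-reflexive (ℕP.+-suc j d)) (ℕP.m≤n+m _ k))
      zero-combination : ∀ a b → - (b ℤ.* + 0 ℤ.+ a ℤ.* + 0) ≡ + 0
      zero-combination = ℤSolver.solve-∀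

  divCubic-exact : ∀ p T → p ≋ cubic a b *ₚ T → divCubic a b p ≋ T
  divCubic-exact p T h = begin
    q                ≈⟨ solve 2 (λ Q T → Q := (Q :- T) :+ T) ≋-refl q T ⟩
    (q -ₚ T) +ₚ T    ≈⟨ +ₚ-congʳ T (quotient≋0 (q -ₚ T) _ _ _ difference≋0) ⟩
    [] +ₚ T          ∎
    where
    open ≋-Reasoning
    open PolySolver
    q = divCubic a b p
    R = remainder (divCubicSt a b p)
    difference≋0 : cubic a b *ₚ (q -ₚ T) +ₚ R ≋ []
    difference≋0 = begin
      cubic a b *ₚ (q -ₚ T) +ₚ R
        ≈⟨ solve 4 (λ C Q T R → C :* (Q :- T) :+ R := (C :* Q :+ R) :- C :* T) ≋-refl (cubic a b) q T R ⟩
      (cubic a b *ₚ q +ₚ R) -ₚ cubic a b *ₚ T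
        ≈⟨ +ₚ-congʳ (negₚ (cubic a b *ₚ T)) (≋-trans (≋-sym (divCubicSt-correct p)) h) ⟩
      cubic a b *ₚ T -ₚ cubic a b *ₚ T
        ≈⟨ +ₚ-inverseʳ (cubic a b *ₚ T) ⟩
      [] ∎

infix 4 _≋ᶜ_
_≋ᶜ_ : CR → CR → Set
u ≋ᶜ v = (re u ≋ re v) × (im u ≋ im v)

≋ᶜ-trans : ∀ {u v w} → u ≋ᶜ v → v ≋ᶜ w → u ≋ᶜ w
≋ᶜ-trans (h₁ , h₂) (g₁ , g₂) = ≋-trans h₁ g₁ , ≋-trans h₂ g₂

oddForm evenForm : Poly → CR
oddForm  P = P ⊕y []
evenForm P = [] ⊕y scaleₚ (+ 2) P

oddForm-cong : ∀ {P Q} → P ≋ Q → oddForm P ≋ᶜ oddForm Q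
oddForm-cong h = h , ≋-refl

evenForm-cong : ∀ {P Q} → P ≋ Q → evenForm P ≋ᶜ evenForm Q
evenForm-cong h = ≋-refl , scaleₚ-cong refl h

module CoordinateRing (a b : ℤ) where
  open Curve a b hiding (isOdd)
  open CubicDivision a b using (divCubic-exact)

  *ᶜ-cong : ∀ {u u′ v v′} → u ≋ᶜ u′ → v ≋ᶜ v′ → u *ᶜ v ≋ᶜ u′ *ᶜ v′
  *ᶜ-cong (h₁ , h₂) (g₁ , g₂) =
    +ₚ-cong (*ₚ-cong h₁ g₁) (*ₚ-cong (*ₚ-cong h₂ g₂) (≋-refl {cubic a b})) , +ₚ-cong (*ₚ-cong h₁ g₂) (*ₚ-cong h₂ g₁)

  -ᶜ-cong : ∀ {u u′ v v′} → u ≋ᶜ u′ → v ≋ᶜ v′ → u -ᶜ v ≋ᶜ u′ -ᶜ v′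
  -ᶜ-cong (h₁ , h₂) (g₁ , g₂) = +ₚ-cong h₁ (negₚ-cong g₁) , +ₚ-cong h₂ (negₚ-cong g₂)

  oddForm-*ᶜ-oddForm : ∀ P Q → oddForm P *ᶜ oddForm Q ≋ᶜ oddForm (P *ₚ Q)
  oddForm-*ᶜ-oddForm P Q = +ₚ-identityʳ (P *ₚ Q) , ≋-trans (+ₚ-identityʳ (P *ₚ [])) (*ₚ-zeroʳ P)

  oddForm-*ᶜ-evenForm : ∀ P Q → oddForm P *ᶜ evenForm Q ≋ᶜ evenForm (P *ₚ Q)
  oddForm-*ᶜ-evenForm P Q = ≋-trans (+ₚ-identityʳ (P *ₚ [])) (*ₚ-zeroʳ P) ,
    ≋-trans (+ₚ-identityʳ (P *ₚ scaleₚ (+ 2) Q))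
            (≋-trans (*ₚ-comm P _) (≋-trans (≋-sym (scaleₚ-*ₚˡ (+ 2) Q P)) (scaleₚ-cong refl (*ₚ-comm Q P))))

  evenForm-*ᶜ-oddForm : ∀ P Q → evenForm P *ᶜ oddForm Q ≋ᶜ evenForm (P *ₚ Q)
  evenForm-*ᶜ-oddForm P Q = *ₚ-zeroˡ (cubic a b) (*ₚ-zeroʳ (scaleₚ (+ 2) P)) , ≋-sym (scaleₚ-*ₚˡ (+ 2) P Q)

  -- (2y)² = 4 (x³ + a x + b)
  evenForm-*ᶜ-evenForm : ∀ P Q → evenForm P *ᶜ evenForm Q ≋ᶜ oddForm (constₚ (+ 4) *ₚ (P *ₚ Q *ₚ cubic a b))
  evenForm-*ᶜ-evenForm P Q =
    ≋-trans (*ₚ-congˡ (cubic a b) (*ₚ-cong (scaleₚ-as-*ₚ (+ 2) P) (scaleₚ-as-*ₚ (+ 2) Q)))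
      (solve 3 (λ P Q K → con (+ 2) :* P :* (con (+ 2) :* Q) :* K := con (+ 4) :* (P :* Q :* K)) ≋-refl P Q (cubic a b)) ,
    *ₚ-zeroʳ (scaleₚ (+ 2) P)
    where open PolySolver

  evenForm-ᶜ-evenForm : ∀ P Q → evenForm P -ᶜ evenForm Q ≋ᶜ evenForm (P -ₚ Q)
  evenForm-ᶜ-evenForm P Q = ≋-refl , ≋-sym (≋-trans (scaleₚ-distribˡ (+ 2) P (negₚ Q))
    (+ₚ-congˡ (scaleₚ (+ 2) P) (≋-trans (scaleₚ-scaleₚ (+ 2) (- (+ 1)) Q) (≋-sym (scaleₚ-scaleₚ (- (+ 1)) (+ 2) Q)))))

  div2y-evenForm : ∀ u S → re u ≋ cubic a b *ₚ (constₚ (+ 4) *ₚ S) → im u ≋ [] → div2y u ≋ᶜ evenForm S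
  div2y-evenForm u S h g = halfₚ-cong g ,
    ≋-trans (halfₚ-cong (divCubic-exact (re u) (constₚ (+ 4) *ₚ S) h))
    (≋-trans (halfₚ-cong (≋-trans (≋-sym (scaleₚ-as-*ₚ (+ 4) S)) (≋-sym (scaleₚ-scaleₚ (+ 2) (+ 2) S))))
             (halfₚ-double (scaleₚ (+ 2) S)))

  sqᶜ-oddForm : ∀ {u} P → u ≋ᶜ oddForm P → sqᶜ u ≋ᶜ oddForm (P *ₚ P)
  sqᶜ-oddForm P h = ≋ᶜ-trans (*ᶜ-cong h h) (oddForm-*ᶜ-oddForm P P)

  sqᶜ-evenForm : ∀ {u} P → u ≋ᶜ evenForm P → sqᶜ u ≋ᶜ oddForm (constₚ (+ 4) *ₚ (P *ₚ P *ₚ cubic a b))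
  sqᶜ-evenForm P h = ≋ᶜ-trans (*ᶜ-cong h h) (evenForm-*ᶜ-evenForm P P)

  cubeᶜ-oddForm : ∀ {u} P → u ≋ᶜ oddForm P → cubeᶜ u ≋ᶜ oddForm (P *ₚ P *ₚ P)
  cubeᶜ-oddForm P h = ≋ᶜ-trans (*ᶜ-cong (sqᶜ-oddForm P h) h) (oddForm-*ᶜ-oddForm (P *ₚ P) P)

  cubeᶜ-evenForm : ∀ {u} P → u ≋ᶜ evenForm P →
    cubeᶜ u ≋ᶜ evenForm (constₚ (+ 4) *ₚ (P *ₚ P *ₚ cubic a b) *ₚ P)
  cubeᶜ-evenForm P h = ≋ᶜ-trans (*ᶜ-cong (sqᶜ-evenForm P h) h) (oddForm-*ᶜ-evenForm (constₚ (+ 4) *ₚ (P *ₚ P *ₚ cubic a b)) P)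

-- Homogeneous polynomials in Z, W

-- Read f : HomPoly s as f₀ Z^s + W (f₁ Z^(s-1) + W (⋯)): multiplying by W
-- conses a zero coefficient, multiplying by Z appends one.

Z*ₕ : ∀ {s} → HomPoly s → HomPoly (suc s)
Z*ₕ {zero}  (a ∷ []) = a ∷ + 0 ∷ []
Z*ₕ {suc s} (a ∷ f)  = a ∷ Z*ₕ f

Z^_*ₕ_ : ∀ k {t} → HomPoly t → HomPoly (k ℕ.+ t)
Z^ zero  *ₕ f = f
Z^ suc k *ₕ f = Z*ₕ (Z^ k *ₕ f)

scaleₕ : ∀ {s} → ℤ → HomPoly s → HomPoly s
scaleₕ c = Vec.map (c ℤ.*_)

_+ₕ_ _-ₕ_ : ∀ {s} → HomPoly s → HomPoly s → HomPoly s
_+ₕ_ = Vec.zipWith ℤ._+_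
_-ₕ_ = Vec.zipWith ℤ._-_

_*ₕ_ : ∀ {s t} → HomPoly s → HomPoly t → HomPoly (s ℕ.+ t)
_*ₕ_ {zero}  (a ∷ []) g = scaleₕ a g
_*ₕ_ {suc s} (a ∷ f)  g = (Z^ suc s *ₕ scaleₕ a g) +ₕ (+ 0 ∷ (f *ₕ g))

Homog : Set
Homog = Σ ℕ HomPoly

deg : Homog → ℕ
deg = proj₁

infixl 7 _·_
infixr 8 _⊙_
infixl 6 _⊖_
infix 9 _² _³

_·_ : Homog → Homog → Homog
(s , f) · (t , g) = s ℕ.+ t , f *ₕ g

_⊙_ : ℤ → Homog → Homog
k ⊙ (s , f) = s , scaleₕ k f

-- Meaningful only for equal degrees; otherwise it returns its second argument.
_⊖_ : Homog → Homog → Homog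
(s , f) ⊖ (t , g) with s ℕ.≟ t
... | yes s≡t = t , (subst HomPoly s≡t f -ₕ g)
... | no _    = t , g

deg-⊖ : ∀ F G → deg (F ⊖ G) ≡ deg G
deg-⊖ (s , f) (t , g) with s ℕ.≟ t
... | yes _ = refl
... | no _  = refl

_² _³ : Homog → Homog
F ² = F · F
F ³ = F · (F · F)

-- Z (Z - W)², the image of y⁴ = x² (x² - D)² under x² ↦ Z, D ↦ W.
Y⁴ : Homog
Y⁴ = 3 , (+ 1 ∷ -[1+ 1 ] ∷ + 1 ∷ + 0 ∷ [])

-- f_{2m+1} from A = f_{m+2}, B = f_m, C = f_{m-1}, G = f_{m+1}:
-- the factor 16 Y⁴ = (2y)⁴ goes with whichever pair has even index.
oddStepᵒ oddStepᵉ : Homog → Homog → Homog → Homog → Homog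
oddStepᵒ A B C G = (A · B ³) ⊖ ((+ 16) ⊙ (Y⁴ · (C · G ³)))
oddStepᵉ A B C G = ((+ 16) ⊙ (Y⁴ · (A · B ³))) ⊖ (C · G ³)

-- f_{2m} from M = f_m, A = f_{m+2}, C = f_{m-1}, E = f_{m-2}, G = f_{m+1},
-- for either parity of m.
evenStep : Homog → Homog → Homog → Homog → Homog → Homog
evenStep M A C E G = M · ((A · C ²) ⊖ (E · G ²))

module Evaluation (R : CommutativeRing 0ℓ 0ℓ)
  (ι : ℤ-rawRing ACR.-Raw-AlmostCommutative⟶ ACR.fromCommutativeRing R)
  (Z W : CommutativeRing.Carrier R) where
  open CommutativeRing R hiding (zero; -_) renaming (refl to ≈-refl; sym to ≈-sym; trans to ≈-trans)
  open ACR._-Raw-AlmostCommutative⟶_ ι renaming (⟦_⟧ to ιℤ)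
  open ℤConstantsSolver R ι public using (solve; _:=_; _:+_; _:*_; _:-_; con)
  open SetoidReasoning setoid

  pow : Carrier → ℕ → Carrier
  pow x zero    = 1#
  pow x (suc k) = x * pow x k

  evalₕ : ∀ s → HomPoly s → Carrier
  evalₕ zero    (a ∷ []) = ιℤ a
  evalₕ (suc s) (a ∷ f)  = ιℤ a * pow Z (suc s) + W * evalₕ s f

  evalₕ-Z* : ∀ s (f : HomPoly s) → evalₕ (suc s) (Z*ₕ f) ≈ Z * evalₕ s f
  evalₕ-Z* zero (a ∷ []) = begin
    ιℤ a * (Z * 1#) + W * ιℤ (+ 0)  ≈⟨ +-cong (*-congˡ (*-identityʳ Z)) (*-congˡ 0-homo) ⟩
    ιℤ a * Z + W * 0#               ≈⟨ +-cong (*-comm (ιℤ a) Z) (zeroʳ W) ⟩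
    Z * ιℤ a + 0#                   ≈⟨ +-identityʳ _ ⟩
    Z * ιℤ a                        ∎
  evalₕ-Z* (suc s) (a ∷ f) = begin
    ιℤ a * (Z * pow Z (suc s)) + W * evalₕ (suc s) (Z*ₕ f)  ≈⟨ +-congˡ (*-congˡ (evalₕ-Z* s f)) ⟩
    ιℤ a * (Z * pow Z (suc s)) + W * (Z * evalₕ s f)
      ≈⟨ solve 5 (λ a z p w h → a :* (z :* p) :+ w :* (z :* h) := z :* (a :* p :+ w :* h))
               ≈-refl (ιℤ a) Z (pow Z (suc s)) W (evalₕ s f) ⟩
    Z * (ιℤ a * pow Z (suc s) + W * evalₕ s f)              ∎

  evalₕ-Z^* : ∀ k t (f : HomPoly t) → evalₕ (k ℕ.+ t) (Z^ k *ₕ f) ≈ pow Z k * evalₕ t f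
  evalₕ-Z^* zero    t f = ≈-sym (*-identityˡ _)
  evalₕ-Z^* (suc k) t f = begin
    evalₕ (suc (k ℕ.+ t)) (Z*ₕ (Z^ k *ₕ f))  ≈⟨ evalₕ-Z* (k ℕ.+ t) (Z^ k *ₕ f) ⟩
    Z * evalₕ (k ℕ.+ t) (Z^ k *ₕ f)          ≈⟨ *-congˡ (evalₕ-Z^* k t f) ⟩
    Z * (pow Z k * evalₕ t f)                ≈⟨ *-assoc _ _ _ ⟨
    Z * pow Z k * evalₕ t f                  ∎

  evalₕ-W* : ∀ s (f : HomPoly s) → evalₕ (suc s) (+ 0 ∷ f) ≈ W * evalₕ s f
  evalₕ-W* s f = begin
    ιℤ (+ 0) * pow Z (suc s) + W * evalₕ s f  ≈⟨ +-congʳ (≈-trans (*-congʳ 0-homo) (zeroˡ _)) ⟩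
    0# + W * evalₕ s f                        ≈⟨ +-identityˡ _ ⟩
    W * evalₕ s f                             ∎

  evalₕ-scale : ∀ s c (f : HomPoly s) → evalₕ s (scaleₕ c f) ≈ ιℤ c * evalₕ s f
  evalₕ-scale zero    c (a ∷ []) = *-homo c a
  evalₕ-scale (suc s) c (a ∷ f) = begin
    ιℤ (c ℤ.* a) * pow Z (suc s) + W * evalₕ s (scaleₕ c f)
      ≈⟨ +-cong (*-congʳ (*-homo c a)) (*-congˡ (evalₕ-scale s c f)) ⟩
    ιℤ c * ιℤ a * pow Z (suc s) + W * (ιℤ c * evalₕ s f)
      ≈⟨ solve 5 (λ c a p w h → c :* a :* p :+ w :* (c :* h) := c :* (a :* p :+ w :* h))
               ≈-refl (ιℤ c) (ιℤ a) (pow Z (suc s)) W (evalₕ s f) ⟩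
    ιℤ c * (ιℤ a * pow Z (suc s) + W * evalₕ s f) ∎

  evalₕ-+ : ∀ s (f g : HomPoly s) → evalₕ s (f +ₕ g) ≈ evalₕ s f + evalₕ s g
  evalₕ-+ zero    (a ∷ []) (b ∷ []) = +-homo a b
  evalₕ-+ (suc s) (a ∷ f)  (b ∷ g)  = begin
    ιℤ (a ℤ.+ b) * pow Z (suc s) + W * evalₕ s (f +ₕ g)
      ≈⟨ +-cong (*-congʳ (+-homo a b)) (*-congˡ (evalₕ-+ s f g)) ⟩
    (ιℤ a + ιℤ b) * pow Z (suc s) + W * (evalₕ s f + evalₕ s g)
      ≈⟨ solve 6 (λ a b p w h k → (a :+ b) :* p :+ w :* (h :+ k) := (a :* p :+ w :* h) :+ (b :* p :+ w :* k))
               ≈-refl (ιℤ a) (ιℤ b) (pow Z (suc s)) W (evalₕ s f) (evalₕ s g) ⟩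
    (ιℤ a * pow Z (suc s) + W * evalₕ s f) + (ιℤ b * pow Z (suc s) + W * evalₕ s g) ∎

  evalₕ-- : ∀ s (f g : HomPoly s) → evalₕ s (f -ₕ g) ≈ evalₕ s f - evalₕ s g
  evalₕ-- zero    (a ∷ []) (b ∷ []) = ι-- a b
    where
    ι-- : ∀ a b → ιℤ (a ℤ.- b) ≈ ιℤ a - ιℤ b
    ι-- a b = ≈-trans (+-homo a (- b)) (+-congˡ (-‿homo b))
  evalₕ-- (suc s) (a ∷ f)  (b ∷ g)  = begin
    ιℤ (a ℤ.- b) * pow Z (suc s) + W * evalₕ s (f -ₕ g)
      ≈⟨ +-cong (*-congʳ (≈-trans (+-homo a (- b)) (+-congˡ (-‿homo b)))) (*-congˡ (evalₕ-- s f g)) ⟩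
    (ιℤ a - ιℤ b) * pow Z (suc s) + W * (evalₕ s f - evalₕ s g)
      ≈⟨ solve 6 (λ a b p w h k → (a :- b) :* p :+ w :* (h :- k) := (a :* p :+ w :* h) :- (b :* p :+ w :* k))
               ≈-refl (ιℤ a) (ιℤ b) (pow Z (suc s)) W (evalₕ s f) (evalₕ s g) ⟩
    (ιℤ a * pow Z (suc s) + W * evalₕ s f) - (ιℤ b * pow Z (suc s) + W * evalₕ s g) ∎

  evalₕ-* : ∀ s t (f : HomPoly s) (g : HomPoly t) → evalₕ (s ℕ.+ t) (f *ₕ g) ≈ evalₕ s f * evalₕ t g
  evalₕ-* zero    t (a ∷ []) g = evalₕ-scale t a g
  evalₕ-* (suc s) t (a ∷ f)  g = begin
    evalₕ (suc (s ℕ.+ t)) ((Z^ suc s *ₕ scaleₕ a g) +ₕ (+ 0 ∷ (f *ₕ g)))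
      ≈⟨ evalₕ-+ (suc (s ℕ.+ t)) (Z^ suc s *ₕ scaleₕ a g) (+ 0 ∷ (f *ₕ g)) ⟩
    evalₕ (suc s ℕ.+ t) (Z^ suc s *ₕ scaleₕ a g) + evalₕ (suc (s ℕ.+ t)) (+ 0 ∷ (f *ₕ g))
      ≈⟨ +-cong (evalₕ-Z^* (suc s) t (scaleₕ a g)) (evalₕ-W* (s ℕ.+ t) (f *ₕ g)) ⟩
    pow Z (suc s) * evalₕ t (scaleₕ a g) + W * evalₕ (s ℕ.+ t) (f *ₕ g)
      ≈⟨ +-cong (*-congˡ (evalₕ-scale t a g)) (*-congˡ (evalₕ-* s t f g)) ⟩
    pow Z (suc s) * (ιℤ a * evalₕ t g) + W * (evalₕ s f * evalₕ t g)
      ≈⟨ solve 5 (λ p a h w k → p :* (a :* h) :+ w :* (k :* h) := (a :* p :+ w :* k) :* h)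
               ≈-refl (pow Z (suc s)) (ιℤ a) (evalₕ t g) W (evalₕ s f) ⟩
    (ιℤ a * pow Z (suc s) + W * evalₕ s f) * evalₕ t g ∎

  eval : Homog → Carrier
  eval (s , f) = evalₕ s f

  eval-· : ∀ F G → eval (F · G) ≈ eval F * eval G
  eval-· (s , f) (t , g) = evalₕ-* s t f g

  eval-⊙ : ∀ k F → eval (k ⊙ F) ≈ ιℤ k * eval F
  eval-⊙ k (s , f) = evalₕ-scale s k f

  eval-⊖ : ∀ F G → deg F ≡ deg G → eval (F ⊖ G) ≈ eval F - eval G
  eval-⊖ (s , f) (t , g) e with s ℕ.≟ t
  ... | yes refl = evalₕ-- t f g
  ... | no s≢t   = ⊥-elim (s≢t e)

  eval-² : ∀ F → eval (F ²) ≈ eval F * eval F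
  eval-² F = eval-· F F

  eval-³ : ∀ F → eval (F ³) ≈ eval F * (eval F * eval F)
  eval-³ F = ≈-trans (eval-· F (F · F)) (*-congˡ (eval-· F F))

  eval-Y⁴ : eval Y⁴ ≈ Z * ((Z - W) * (Z - W))
  eval-Y⁴ = begin
    ιℤ (+ 1) * (Z * (Z * (Z * 1#))) + W * (ιℤ -[1+ 1 ] * (Z * (Z * 1#)) + W * (ιℤ (+ 1) * (Z * 1#) + W * ιℤ (+ 0)))
      ≈⟨ +-cong (*-congˡ (*-congˡ (*-congˡ (*-identityʳ Z))))
                (*-congˡ (+-cong (*-congˡ (*-congˡ (*-identityʳ Z))) (*-congˡ (+-congʳ (*-congˡ (*-identityʳ Z)))))) ⟩
    ιℤ (+ 1) * (Z * (Z * Z)) + W * (ιℤ -[1+ 1 ] * (Z * Z) + W * (ιℤ (+ 1) * Z + W * ιℤ (+ 0)))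
      ≈⟨ solve 2 (λ Z W →
           con (+ 1) :* (Z :* (Z :* Z)) :+ W :* (con -[1+ 1 ] :* (Z :* Z) :+ W :* (con (+ 1) :* Z :+ W :* con (+ 0)))
         := Z :* ((Z :- W) :* (Z :- W))) ≈-refl Z W ⟩
    Z * ((Z - W) * (Z - W)) ∎

  eval-oddStepᵒ : ∀ A B C G → deg (A · B ³) ≡ deg ((+ 16) ⊙ (Y⁴ · (C · G ³))) →
    eval (oddStepᵒ A B C G)
      ≈ eval A * (eval B * (eval B * eval B)) - ιℤ (+ 16) * (eval Y⁴ * (eval C * (eval G * (eval G * eval G))))
  eval-oddStepᵒ A B C G e = ≈-trans (eval-⊖ (A · B ³) ((+ 16) ⊙ (Y⁴ · (C · G ³))) e)
    (+-cong (≈-trans (eval-· A (B ³)) (*-congˡ (eval-³ B)))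
            (-‿cong (≈-trans (eval-⊙ (+ 16) (Y⁴ · (C · G ³)))
              (*-congˡ (≈-trans (eval-· Y⁴ (C · G ³)) (*-congˡ (≈-trans (eval-· C (G ³)) (*-congˡ (eval-³ G)))))))))

  eval-oddStepᵉ : ∀ A B C G → deg ((+ 16) ⊙ (Y⁴ · (A · B ³))) ≡ deg (C · G ³) →
    eval (oddStepᵉ A B C G)
      ≈ ιℤ (+ 16) * (eval Y⁴ * (eval A * (eval B * (eval B * eval B)))) - eval C * (eval G * (eval G * eval G))
  eval-oddStepᵉ A B C G e = ≈-trans (eval-⊖ ((+ 16) ⊙ (Y⁴ · (A · B ³))) (C · G ³) e)
    (+-cong (≈-trans (eval-⊙ (+ 16) (Y⁴ · (A · B ³)))
              (*-congˡ (≈-trans (eval-· Y⁴ (A · B ³)) (*-congˡ (≈-trans (eval-· A (B ³)) (*-congˡ (eval-³ B)))))))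
            (-‿cong (≈-trans (eval-· C (G ³)) (*-congˡ (eval-³ G)))))

  eval-evenStep : ∀ M A C E G → deg (A · C ²) ≡ deg (E · G ²) →
    eval (evenStep M A C E G) ≈ eval M * (eval A * (eval C * eval C) - eval E * (eval G * eval G))
  eval-evenStep M A C E G e = ≈-trans (eval-· M ((A · C ²) ⊖ (E · G ²))) (*-congˡ
    (≈-trans (eval-⊖ (A · C ²) (E · G ²) e)
      (+-cong (≈-trans (eval-· A (C ²)) (*-congˡ (eval-² C)))
              (-‿cong (≈-trans (eval-· E (G ²)) (*-congˡ (eval-² G)))))))

module EvalPoly (Z W : Poly) = Evaluation ℤ[x] constₚ-morphism Z W
module EvalCurve (D : ℤ) = EvalPoly (Xₚ ^ₚ 2) (constₚ D)
module Eval10 = Evaluation ℤP.+-*-commutativeRing ℤ-identity-morphism (+ 1) (+ 0)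
module Eval01 = Evaluation ℤP.+-*-commutativeRing ℤ-identity-morphism (+ 0) (+ 1)

sumₚ-cong : ∀ {n} (h h′ : Fin n → Poly) → (∀ i → h i ≋ h′ i) →
  sumₚ (Vec.toList (Vec.tabulate h)) ≋ sumₚ (Vec.toList (Vec.tabulate h′))
sumₚ-cong {zero}  h h′ e = ≋-refl
sumₚ-cong {suc n} h h′ e = +ₚ-cong (e zero) (sumₚ-cong (λ i → h (suc i)) (λ i → h′ (suc i)) (λ i → e (suc i)))

sumₚ-*ₚ : ∀ {n} W (h : Fin n → Poly) →
  sumₚ (Vec.toList (Vec.tabulate (λ i → W *ₚ h i))) ≋ W *ₚ sumₚ (Vec.toList (Vec.tabulate h))
sumₚ-*ₚ {zero}  W h = ≋-sym (*ₚ-zeroʳ W)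
sumₚ-*ₚ {suc n} W h = ≋-trans (+ₚ-congˡ (W *ₚ h zero) (sumₚ-*ₚ W (λ i → h (suc i))))
  (≋-sym (*ₚ-distribˡ W (h zero) (sumₚ (Vec.toList (Vec.tabulate (λ i → h (suc i)))))))

evalHom≋evalₕ : ∀ Z W s (f : HomPoly s) → evalHom s f Z W ≋ EvalPoly.evalₕ Z W s f
evalHom≋evalₕ Z W zero (a ∷ []) =
  ≋-trans (+ₚ-identityʳ _) (solve 1 (λ A → A :* con (+ 1) :* con (+ 1) := A) ≋-refl (constₚ a))
  where open PolySolver
evalHom≋evalₕ Z W (suc s) (a ∷ f) =
  +ₚ-cong (≋-trans (solve 2 (λ A P → A :* P :* con (+ 1) := A :* P) ≋-refl (constₚ a) (Z ^ₚ suc s))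
                   (≡⇒≋ (cong (constₚ a *ₚ_) (^ₚ≡pow (suc s)))))
  (≋-trans (sumₚ-cong _ (λ i → W *ₚ term i)
              (λ i → solve 4 (λ A P W Q → A :* P :* (W :* Q) := W :* (A :* P :* Q)) ≋-refl
                             (constₚ (lookup f i)) (Z ^ₚ (s ∸ toℕ i)) W (W ^ₚ toℕ i)))
  (≋-trans (sumₚ-*ₚ W term) (*ₚ-congʳ W (evalHom≋evalₕ Z W s f))))
  where
  open PolySolver
  open EvalPoly Z W using (pow)
  term : Fin (suc s) → Poly
  term i = constₚ (lookup f i) *ₚ (Z ^ₚ (s ∸ toℕ i)) *ₚ (W ^ₚ toℕ i)
  ^ₚ≡pow : ∀ k → Z ^ₚ k ≡ pow Z k
  ^ₚ≡pow zero    = refl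
  ^ₚ≡pow (suc k) = cong (Z *ₚ_) (^ₚ≡pow k)

lookup-first≡eval10 : ∀ s (f : HomPoly s) → lookup f zero ≡ Eval10.evalₕ s f
lookup-first≡eval10 zero    (a ∷ []) = refl
lookup-first≡eval10 (suc s) (a ∷ f)  =
  sym (trans (cong (λ x → a ℤ.* x ℤ.+ + 0) (pow1 (suc s))) (trans (ℤP.+-identityʳ _) (ℤP.*-identityʳ a)))
  where
  pow1 : ∀ k → Eval10.pow (+ 1) k ≡ + 1
  pow1 zero    = refl
  pow1 (suc k) = trans (ℤP.*-identityˡ _) (pow1 k)

lookup-last≡eval01 : ∀ s (f : HomPoly s) → lookup f (fromℕ s) ≡ Eval01.evalₕ s f
lookup-last≡eval01 zero    (a ∷ []) = refl
lookup-last≡eval01 (suc s) (a ∷ f)  = trans (lookup-last≡eval01 s f)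
  (sym (trans (cong (λ x → x ℤ.+ + 1 ℤ.* Eval01.evalₕ s f) (ℤP.*-zeroʳ a))
              (trans (ℤP.+-identityˡ _) (ℤP.*-identityˡ _))))

oddStepAt evenStepAt : (ℕ → Homog) → ℕ → Homog
oddStepAt F m = (if isOdd m then oddStepᵒ else oddStepᵉ) (F (m ℕ.+ 2)) (F m) (F (m ∸ 1)) (F (m ℕ.+ 1))
evenStepAt F m = evenStep (F m) (F (m ℕ.+ 2)) (F (m ∸ 1)) (F (m ∸ 2)) (F (m ℕ.+ 1))

-- The first argument is fuel, exactly as for ψ′.
f′ : ℕ → ℕ → Homog
f′ zero    _ = 0 , + 0 ∷ []
f′ (suc k) 0 = 0 , + 0 ∷ []
f′ (suc k) 1 = 0 , + 1 ∷ []
f′ (suc k) 2 = 0 , + 1 ∷ []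
f′ (suc k) 3 = 2 , + 3 ∷ -[1+ 5 ] ∷ -[1+ 0 ] ∷ []
f′ (suc k) 4 = 3 , + 2 ∷ -[1+ 9 ] ∷ -[1+ 9 ] ∷ + 2 ∷ []
f′ (suc k) n@(suc (suc (suc (suc (suc _))))) =
  if isOdd n then oddStepAt (f′ k) ⌊ n /2⌋ else evenStepAt (f′ k) ⌊ n /2⌋

double : ℕ → ℕ
double zero    = zero
double (suc n) = suc (suc (double n))

double≡+ : ∀ n → double n ≡ n ℕ.+ n
double≡+ zero    = refl
double≡+ (suc n) = cong suc (trans (cong suc (double≡+ n)) (sym (ℕP.+-suc n n)))

isOdd-double : ∀ a b n → Curve.isOdd a b (double n) ≡ false
isOdd-double a b zero    = refl
isOdd-double a b (suc n) = isOdd-double a b n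

isOdd-suc-double : ∀ a b n → Curve.isOdd a b (suc (double n)) ≡ true
isOdd-suc-double a b zero    = refl
isOdd-suc-double a b (suc n) = isOdd-suc-double a b n

⌊double/2⌋ : ∀ n → ⌊ double n /2⌋ ≡ n
⌊double/2⌋ zero    = refl
⌊double/2⌋ (suc n) = cong suc (⌊double/2⌋ n)

⌊suc-double/2⌋ : ∀ n → ⌊ suc (double n) /2⌋ ≡ n
⌊suc-double/2⌋ zero    = refl
⌊suc-double/2⌋ (suc n) = cong suc (⌊suc-double/2⌋ n)

double/2 : ∀ n → double n ℕD./ 2 ≡ n
double/2 n = trans (cong (ℕD._/ 2) (trans (double≡+ n) (n+n≡n*2 n))) (ℕD.m*n/n≡m n 2)
  where
  n+n≡n*2 : ∀ n → n ℕ.+ n ≡ n ℕ.* 2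
  n+n≡n*2 = ℕSolver.solve-∀

+double : ∀ n → + double n ≡ + n ℤ.+ + n
+double n = trans (cong +_ (double≡+ n)) (ℤP.pos-+ n n)

if-true : ∀ {A : Set} {b : Bool} {x y : A} → b ≡ true → (if b then x else y) ≡ x
if-true refl = refl

if-false : ∀ {A : Set} {b : Bool} {x y : A} → b ≡ false → (if b then x else y) ≡ y
if-false refl = refl

sₙ-odd : ∀ j → sₙ (suc (double j)) ≡ j ℕ.* j ℕ.+ j
sₙ-odd j = trans (if-true (isOdd-suc-double (+ 0) (+ 0) j))
  (trans (cong (λ x → (suc x ℕ.* suc x ∸ 1) ℕD./ 4) (double≡+ j))
  (trans (cong (λ x → (x ∸ 1) ℕD./ 4) (square j)) (ℕD.m*n/n≡m (j ℕ.* j ℕ.+ j) 4)))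
  where
  square : ∀ j → suc (j ℕ.+ j) ℕ.* suc (j ℕ.+ j) ≡ suc ((j ℕ.* j ℕ.+ j) ℕ.* 4)
  square = ℕSolver.solve-∀

sₙ-even : ∀ j → sₙ (double (suc j)) ≡ j ℕ.* j ℕ.+ 2 ℕ.* j
sₙ-even j = trans (if-false (isOdd-double (+ 0) (+ 0) (suc j)))
  (trans (cong (λ x → (x ℕ.* x ∸ 4) ℕD./ 4) (double≡+ (suc j)))
  (trans (cong (λ x → (x ∸ 4) ℕD./ 4) (square j)) (ℕD.m*n/n≡m (j ℕ.* j ℕ.+ 2 ℕ.* j) 4)))
  where
  square : ∀ j → (suc j ℕ.+ suc j) ℕ.* (suc j ℕ.+ suc j) ≡ 4 ℕ.+ (j ℕ.* j ℕ.+ 2 ℕ.* j) ℕ.* 4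
  square = ℕSolver.solve-∀

cₙ-odd : ∀ j → cₙ (suc (double j)) ≡ + 1 ℤ.+ (+ j ℤ.+ + j)
cₙ-odd j = trans (if-true (isOdd-suc-double (+ 0) (+ 0) j)) (cong (λ x → + 1 ℤ.+ x) (+double j))

cₙ-even : ∀ j → cₙ (double (suc j)) ≡ + 1 ℤ.+ + j
cₙ-even j = trans (if-false (isOdd-double (+ 0) (+ 0) (suc j))) (cong +_ (double/2 (suc j)))

dₙ-odd : ∀ j → dₙ (suc (double j)) ≡ (- (+ 1)) ℤ.^ j
dₙ-odd j = trans (if-true (isOdd-suc-double (+ 0) (+ 0) j)) (cong ((- (+ 1)) ℤ.^_) (double/2 j))

dₙ-even : ∀ j → dₙ (double (suc j)) ≡ + 1 ℤ.+ + j
dₙ-even j = trans (if-false (isOdd-double (+ 0) (+ 0) (suc j))) (cong +_ (double/2 (suc j)))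

sign²≡1 : ∀ j → ((- (+ 1)) ℤ.^ j) ℤ.* ((- (+ 1)) ℤ.^ j) ≡ + 1
sign²≡1 zero    = refl
sign²≡1 (suc j) = trans (square-neg ((- (+ 1)) ℤ.^ j)) (sign²≡1 j)
  where
  square-neg : ∀ s → ((- (+ 1)) ℤ.* s) ℤ.* ((- (+ 1)) ℤ.* s) ≡ s ℤ.* s
  square-neg = ℤSolver.solve-∀

sign-double≡1 : ∀ j → (- (+ 1)) ℤ.^ (double j) ≡ + 1
sign-double≡1 zero    = refl
sign-double≡1 (suc j) = trans (neg-neg ((- (+ 1)) ℤ.^ double j)) (sign-double≡1 j)
  where
  neg-neg : ∀ s → (- (+ 1)) ℤ.* ((- (+ 1)) ℤ.* s) ≡ s
  neg-neg = ℤSolver.solve-∀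

f′-odd : ∀ k m → 2 ≤ m → f′ (suc k) (suc (double m)) ≡ oddStepAt (f′ k) m
f′-odd k (suc zero) (s≤s ())
f′-odd k (suc (suc m)) _
  rewrite isOdd-suc-double (+ 0) (+ 0) m | ⌊suc-double/2⌋ m = refl

f′-even : ∀ k m → 3 ≤ m → f′ (suc k) (double m) ≡ evenStepAt (f′ k) m
f′-even k (suc zero)       (s≤s ())
f′-even k (suc (suc zero)) (s≤s (s≤s ()))
f′-even k (suc (suc (suc m))) _
  rewrite isOdd-double (+ 0) (+ 0) m | ⌊double/2⌋ m = refl

module Recurrence (a b : ℤ) where
  open Curve a b hiding (isOdd)
  open CoordinateRing a b
  open PolySolver

  ψ-oddStep ψ-evenStep : (ℕ → CR) → ℕ → CR
  ψ-oddStep  P m = P (m ℕ.+ 2) *ᶜ cubeᶜ (P m) -ᶜ P (m ∸ 1) *ᶜ cubeᶜ (P (m ℕ.+ 1))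
  ψ-evenStep P m = div2y (P m *ᶜ (P (m ℕ.+ 2) *ᶜ sqᶜ (P (m ∸ 1)) -ᶜ P (m ∸ 2) *ᶜ sqᶜ (P (m ℕ.+ 1))))

  ψ′-odd : ∀ k m → 2 ≤ m → ψ′ (suc k) (suc (double m)) ≡ ψ-oddStep (ψ′ k) m
  ψ′-odd k (suc zero) (s≤s ())
  ψ′-odd k (suc (suc m)) _
    rewrite isOdd-suc-double a b m | ⌊suc-double/2⌋ m = refl

  ψ′-even : ∀ k m → 3 ≤ m → ψ′ (suc k) (double m) ≡ ψ-evenStep (ψ′ k) m
  ψ′-even k (suc zero)       (s≤s ())
  ψ′-even k (suc (suc zero)) (s≤s (s≤s ()))
  ψ′-even k (suc (suc (suc m))) _
    rewrite isOdd-double a b m | ⌊double/2⌋ m = refl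

  ψ-oddStep-evenMid : ∀ P m {A B C G} →
    P (m ℕ.+ 2) ≋ᶜ evenForm A → P m ≋ᶜ evenForm B → P (m ∸ 1) ≋ᶜ oddForm C → P (m ℕ.+ 1) ≋ᶜ oddForm G →
    ψ-oddStep P m ≋ᶜ oddForm (constₚ (+ 16) *ₚ ((cubic a b *ₚ cubic a b) *ₚ (A *ₚ (B *ₚ (B *ₚ B))))
                              -ₚ C *ₚ (G *ₚ (G *ₚ G)))
  ψ-oddStep-evenMid P m {A} {B} {C} {G} hA hB hC hG = ≋ᶜ-trans
    (-ᶜ-cong (≋ᶜ-trans (*ᶜ-cong hA (cubeᶜ-evenForm B hB))
                       (evenForm-*ᶜ-evenForm A (constₚ (+ 4) *ₚ (B *ₚ B *ₚ cubic a b) *ₚ B)))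
             (≋ᶜ-trans (*ᶜ-cong hC (cubeᶜ-oddForm G hG)) (oddForm-*ᶜ-oddForm C (G *ₚ G *ₚ G))))
    (oddForm-cong (solve 5 (λ A B C G K →
        con (+ 4) :* (A :* (con (+ 4) :* (B :* B :* K) :* B) :* K) :- C :* (G :* G :* G)
      := con (+ 16) :* ((K :* K) :* (A :* (B :* (B :* B)))) :- C :* (G :* (G :* G)))
      ≋-refl A B C G (cubic a b)))

  ψ-oddStep-oddMid : ∀ P m {A B C G} →
    P (m ℕ.+ 2) ≋ᶜ oddForm A → P m ≋ᶜ oddForm B → P (m ∸ 1) ≋ᶜ evenForm C → P (m ℕ.+ 1) ≋ᶜ evenForm G →
    ψ-oddStep P m ≋ᶜ oddForm (A *ₚ (B *ₚ (B *ₚ B))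
                              -ₚ constₚ (+ 16) *ₚ ((cubic a b *ₚ cubic a b) *ₚ (C *ₚ (G *ₚ (G *ₚ G)))))
  ψ-oddStep-oddMid P m {A} {B} {C} {G} hA hB hC hG = ≋ᶜ-trans
    (-ᶜ-cong (≋ᶜ-trans (*ᶜ-cong hA (cubeᶜ-oddForm B hB)) (oddForm-*ᶜ-oddForm A (B *ₚ B *ₚ B)))
             (≋ᶜ-trans (*ᶜ-cong hC (cubeᶜ-evenForm G hG))
                       (evenForm-*ᶜ-evenForm C (constₚ (+ 4) *ₚ (G *ₚ G *ₚ cubic a b) *ₚ G))))
    (oddForm-cong (solve 5 (λ A B C G K →
        A :* (B :* B :* B) :- con (+ 4) :* (C :* (con (+ 4) :* (G :* G :* K) :* G) :* K)
      := A :* (B :* (B :* B)) :- con (+ 16) :* ((K :* K) :* (C :* (G :* (G :* G)))))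
      ≋-refl A B C G (cubic a b)))

  ψ-evenStep-evenMid : ∀ P m {M A C E G} →
    P m ≋ᶜ evenForm M → P (m ℕ.+ 2) ≋ᶜ evenForm A → P (m ∸ 1) ≋ᶜ oddForm C →
    P (m ∸ 2) ≋ᶜ evenForm E → P (m ℕ.+ 1) ≋ᶜ oddForm G →
    ψ-evenStep P m ≋ᶜ evenForm (M *ₚ (A *ₚ (C *ₚ C) -ₚ E *ₚ (G *ₚ G)))
  ψ-evenStep-evenMid P m {M} {A} {C} {E} {G} hM hA hC hE hG =
    div2y-evenForm _ (M *ₚ N) (≋-trans (proj₁ product) (solve 3 (λ M N K →
      con (+ 4) :* (M :* N :* K) := K :* (con (+ 4) :* (M :* N))) ≋-refl M N (cubic a b))) (proj₂ product)
    where
    N = A *ₚ (C *ₚ C) -ₚ E *ₚ (G *ₚ G)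
    product = ≋ᶜ-trans (*ᶜ-cong hM (≋ᶜ-trans
      (-ᶜ-cong (≋ᶜ-trans (*ᶜ-cong hA (sqᶜ-oddForm C hC)) (evenForm-*ᶜ-oddForm A (C *ₚ C)))
               (≋ᶜ-trans (*ᶜ-cong hE (sqᶜ-oddForm G hG)) (evenForm-*ᶜ-oddForm E (G *ₚ G))))
      (evenForm-ᶜ-evenForm (A *ₚ (C *ₚ C)) (E *ₚ (G *ₚ G)))))
      (evenForm-*ᶜ-evenForm M N)

  ψ-evenStep-oddMid : ∀ P m {M A C E G} →
    P m ≋ᶜ oddForm M → P (m ℕ.+ 2) ≋ᶜ oddForm A → P (m ∸ 1) ≋ᶜ evenForm C →
    P (m ∸ 2) ≋ᶜ oddForm E → P (m ℕ.+ 1) ≋ᶜ evenForm G →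
    ψ-evenStep P m ≋ᶜ evenForm (M *ₚ (A *ₚ (C *ₚ C) -ₚ E *ₚ (G *ₚ G)))
  ψ-evenStep-oddMid P m {M} {A} {C} {E} {G} hM hA hC hE hG =
    div2y-evenForm _ (M *ₚ (A *ₚ (C *ₚ C) -ₚ E *ₚ (G *ₚ G))) (≋-trans (proj₁ product) (solve 6 (λ M A C E G K →
        M :* (A :* (con (+ 4) :* (C :* C :* K)) :- E :* (con (+ 4) :* (G :* G :* K)))
      := K :* (con (+ 4) :* (M :* (A :* (C :* C) :- E :* (G :* G))))) ≋-refl M A C E G (cubic a b)))
      (proj₂ product)
    where
    A′ = A *ₚ (constₚ (+ 4) *ₚ (C *ₚ C *ₚ cubic a b))
    E′ = E *ₚ (constₚ (+ 4) *ₚ (G *ₚ G *ₚ cubic a b))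
    product = ≋ᶜ-trans (*ᶜ-cong hM
      (-ᶜ-cong (≋ᶜ-trans (*ᶜ-cong hA (sqᶜ-evenForm C hC)) (oddForm-*ᶜ-oddForm A (constₚ (+ 4) *ₚ (C *ₚ C *ₚ cubic a b))))
               (≋ᶜ-trans (*ᶜ-cong hE (sqᶜ-evenForm G hG)) (oddForm-*ᶜ-oddForm E (constₚ (+ 4) *ₚ (G *ₚ G *ₚ cubic a b))))))
      (oddForm-*ᶜ-oddForm M (A′ -ₚ E′))

module _ (D : ℤ) where
  open ≋-Reasoning
  open PolySolver
  private
    δ = constₚ D

  cubic²≋eval-Y⁴ : cubic (- D) (+ 0) *ₚ cubic (- D) (+ 0) ≋ EvalCurve.eval D Y⁴
  cubic²≋eval-Y⁴ = begin
    cubic (- D) (+ 0) *ₚ cubic (- D) (+ 0)  ≈⟨ *ₚ-cong cubic≋ cubic≋ ⟩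
    K *ₚ K
      ≈⟨ solve 2 (λ X D →
           (con (+ 0) :+ X :* ((:- D) :+ X :* (con (+ 0) :+ X :* con (+ 1))))
             :* (con (+ 0) :+ X :* ((:- D) :+ X :* (con (+ 0) :+ X :* con (+ 1))))
         := (X :* (X :* con (+ 1))) :* (((X :* (X :* con (+ 1))) :- D) :* ((X :* (X :* con (+ 1))) :- D)))
         ≋-refl Xₚ δ ⟩
    Xₚ ^ₚ 2 *ₚ ((Xₚ ^ₚ 2 -ₚ δ) *ₚ (Xₚ ^ₚ 2 -ₚ δ))  ≈⟨ EvalCurve.eval-Y⁴ D ⟨
    EvalCurve.eval D Y⁴                         ∎
    where
    K = hornerᴾ (constₚ (+ 0) ∷ negₚ δ ∷ constₚ (+ 0) ∷ constₚ (+ 1) ∷ [])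
    cubic≋ : cubic (- D) (+ 0) ≋ K
    cubic≋ = ≋-trans (≋-hornerᴾ (cubic (- D) (+ 0))) (hornerᴾ-cong (≋-refl {constₚ (+ 0)} ∷ constₚ-neg D ∷ ≋-refl {constₚ (+ 0)} ∷ ≋-refl {constₚ (+ 1)} ∷ []))

  divPoly₃ : re (Curve.ψ3 (- D) (+ 0)) ≋ EvalCurve.eval D (f′ 1 3)
  divPoly₃ = begin
    re (Curve.ψ3 (- D) (+ 0))
      ≈⟨ ≋-trans (≋-hornerᴾ _) (hornerᴾ-cong (d² ∷ ≋-refl {constₚ (+ 0)} ∷ 6d ∷ ≋-refl {constₚ (+ 0)} ∷ ≋-refl {constₚ (+ 3)} ∷ [])) ⟩
    hornerᴾ (negₚ (negₚ δ *ₚ negₚ δ) ∷ constₚ (+ 0) ∷ constₚ (+ 6) *ₚ negₚ δ ∷ constₚ (+ 0) ∷ constₚ (+ 3) ∷ [])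
      ≈⟨ solve 2 (λ X D →
           :- ((:- D) :* (:- D)) :+ X :* (con (+ 0) :+ X :* ((con (+ 6) :* (:- D)) :+ X :* (con (+ 0) :+ X :* con (+ 3))))
         := con (+ 3) :* ((X :* (X :* con (+ 1))) :* ((X :* (X :* con (+ 1))) :* con (+ 1)))
            :+ D :* (con -[1+ 5 ] :* ((X :* (X :* con (+ 1))) :* con (+ 1)) :+ D :* con -[1+ 0 ]))
         ≋-refl Xₚ δ ⟩
    EvalCurve.eval D (f′ 1 3) ∎
    where
    d² : constₚ (- ((- D) ℤ.* (- D))) ≋ negₚ (negₚ δ *ₚ negₚ δ)
    d² = ≋-trans (constₚ-neg _) (negₚ-cong (≋-trans (constₚ-* (- D) (- D)) (*ₚ-cong (constₚ-neg D) (constₚ-neg D))))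
    6d : constₚ (+ 6 ℤ.* (- D)) ≋ constₚ (+ 6) *ₚ negₚ δ
    6d = ≋-trans (constₚ-* (+ 6) (- D)) (*ₚ-congʳ (constₚ (+ 6)) (constₚ-neg D))

  divPoly₄ : im (Curve.ψ4 (- D) (+ 0)) ≋ scaleₚ (+ 2) (EvalCurve.eval D (f′ 1 4))
  divPoly₄ = begin
    scaleₚ (+ 4) L           ≈⟨ scaleₚ-as-*ₚ (+ 4) L ⟩
    constₚ (+ 4) *ₚ L
      ≈⟨ *ₚ-congʳ (constₚ (+ 4)) (≋-trans (≋-hornerᴾ L) (hornerᴾ-cong (e₀ ∷ e₁ ∷ e₂ ∷ ≋-refl {constₚ (+ 0)} ∷ e₄ ∷ ≋-refl {constₚ (+ 0)} ∷ ≋-refl {constₚ (+ 1)} ∷ []))) ⟩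
    constₚ (+ 4) *ₚ hornerᴾ (constₚ (+ 0) -ₚ (negₚ δ *ₚ negₚ δ) *ₚ negₚ δ ∷ negₚ (constₚ (+ 4) *ₚ negₚ δ *ₚ constₚ (+ 0))
                             ∷ negₚ (constₚ (+ 5) *ₚ negₚ δ *ₚ negₚ δ) ∷ constₚ (+ 0) ∷ constₚ (+ 5) *ₚ negₚ δ
                             ∷ constₚ (+ 0) ∷ constₚ (+ 1) ∷ [])
      ≈⟨ solve 2 (λ X D →
           con (+ 4) :* ((con (+ 0) :- ((:- D) :* (:- D)) :* (:- D)) :+ X :* ((:- (con (+ 4) :* (:- D) :* con (+ 0)))
             :+ X :* ((:- (con (+ 5) :* (:- D) :* (:- D))) :+ X :* (con (+ 0) :+ X :* ((con (+ 5) :* (:- D))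
             :+ X :* (con (+ 0) :+ X :* con (+ 1)))))))
         := con (+ 2) :* (con (+ 2) :* (Z X :* (Z X :* (Z X :* con (+ 1))))
              :+ D :* (con -[1+ 9 ] :* (Z X :* (Z X :* con (+ 1)))
              :+ D :* (con -[1+ 9 ] :* (Z X :* con (+ 1)) :+ D :* con (+ 2)))))
         ≋-refl Xₚ δ ⟩
    constₚ (+ 2) *ₚ EvalCurve.eval D (f′ 1 4)   ≈⟨ scaleₚ-as-*ₚ (+ 2) (EvalCurve.eval D (f′ 1 4)) ⟨
    scaleₚ (+ 2) (EvalCurve.eval D (f′ 1 4)) ∎
    where
    a = - D
    L = (+ 0 ℤ.- a ℤ.* a ℤ.* a) ∷ (- (+ 4 ℤ.* a ℤ.* + 0)) ∷ (- (+ 5 ℤ.* a ℤ.* a))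
          ∷ + 0 ∷ (+ 5 ℤ.* a) ∷ + 0 ∷ + 1 ∷ []
    Z = λ X → X :* (X :* con (+ 1))
    e₀ : constₚ (+ 0 ℤ.- a ℤ.* a ℤ.* a) ≋ constₚ (+ 0) -ₚ (negₚ δ *ₚ negₚ δ) *ₚ negₚ δ
    e₀ = ≋-trans (constₚ-- (+ 0) (a ℤ.* a ℤ.* a)) (+ₚ-congˡ (constₚ (+ 0)) (negₚ-cong
           (≋-trans (constₚ-* (a ℤ.* a) a) (*ₚ-cong (≋-trans (constₚ-* a a) (*ₚ-cong (constₚ-neg D) (constₚ-neg D))) (constₚ-neg D)))))
    e₁ : constₚ (- (+ 4 ℤ.* a ℤ.* + 0)) ≋ negₚ (constₚ (+ 4) *ₚ negₚ δ *ₚ constₚ (+ 0))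
    e₁ = ≋-trans (constₚ-neg _) (negₚ-cong (≋-trans (constₚ-* (+ 4 ℤ.* a) (+ 0))
           (*ₚ-congˡ (constₚ (+ 0)) (≋-trans (constₚ-* (+ 4) a) (*ₚ-congʳ (constₚ (+ 4)) (constₚ-neg D))))))
    e₂ : constₚ (- (+ 5 ℤ.* a ℤ.* a)) ≋ negₚ (constₚ (+ 5) *ₚ negₚ δ *ₚ negₚ δ)
    e₂ = ≋-trans (constₚ-neg _) (negₚ-cong (≋-trans (constₚ-* (+ 5 ℤ.* a) a)
           (*ₚ-cong (≋-trans (constₚ-* (+ 5) a) (*ₚ-congʳ (constₚ (+ 5)) (constₚ-neg D))) (constₚ-neg D))))
    e₄ : constₚ (+ 5 ℤ.* a) ≋ constₚ (+ 5) *ₚ negₚ δ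
    e₄ = ≋-trans (constₚ-* (+ 5) a) (*ₚ-congʳ (constₚ (+ 5)) (constₚ-neg D))

-- The inductive invariant

formOf : ℕ → Poly → CR
formOf n P = if isOdd n then oddForm P else evenForm P

formOf-cong : ∀ n {P Q} → P ≋ Q → formOf n P ≋ᶜ formOf n Q
formOf-cong n h with isOdd n
... | true  = oddForm-cong h
... | false = evenForm-cong h

ψᴰ : ℤ → ℕ → ℕ → CR
ψᴰ D = Curve.ψ′ (- D) (+ 0)

record Invariant (k n : ℕ) : Set where
  field
    degree   : deg (f′ k n) ≡ sₙ n
    divPoly≋ : ∀ D → ψᴰ D k n ≋ᶜ formOf n (EvalCurve.eval D (f′ k n))
    lead     : Eval10.eval (f′ k n) ≡ cₙ n
    trail    : Eval01.eval (f′ k n) ≡ dₙ n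

-- The invariant at n = 2j + 1, with the closed forms of s, c and d.
record OddInvariant (k n j : ℕ) : Set where
  field
    degree   : deg (f′ k n) ≡ j ℕ.* j ℕ.+ j
    divPoly≋ : ∀ D → ψᴰ D k n ≋ᶜ oddForm (EvalCurve.eval D (f′ k n))
    lead     : Eval10.eval (f′ k n) ≡ + 1 ℤ.+ (+ j ℤ.+ + j)
    trail    : Eval01.eval (f′ k n) ≡ (- (+ 1)) ℤ.^ j

-- The invariant at n = 2j + 2.
record EvenInvariant (k n j : ℕ) : Set where
  field
    degree   : deg (f′ k n) ≡ j ℕ.* j ℕ.+ 2 ℕ.* j
    divPoly≋ : ∀ D → ψᴰ D k n ≋ᶜ evenForm (EvalCurve.eval D (f′ k n))
    lead     : Eval10.eval (f′ k n) ≡ + 1 ℤ.+ + j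
    trail    : Eval01.eval (f′ k n) ≡ + 1 ℤ.+ + j

module Odd  = OddInvariant
module Even = EvenInvariant

toOdd : ∀ {k n} j → n ≡ suc (double j) → Invariant k n → OddInvariant k n j
toOdd {k} j refl inv = record
  { degree   = trans degree (sₙ-odd j)
  ; divPoly≋ = λ D → subst (ψᴰ D k (suc (double j)) ≋ᶜ_) (if-true (isOdd-suc-double (+ 0) (+ 0) j)) (divPoly≋ D)
  ; lead     = trans lead (cₙ-odd j)
  ; trail    = trans trail (dₙ-odd j) }
  where open Invariant inv

fromOdd : ∀ {k n} j → n ≡ suc (double j) → OddInvariant k n j → Invariant k n
fromOdd {k} j refl inv = record
  { degree   = trans degree (sym (sₙ-odd j))
  ; divPoly≋ = λ D → subst (ψᴰ D k (suc (double j)) ≋ᶜ_) (sym (if-true (isOdd-suc-double (+ 0) (+ 0) j))) (divPoly≋ D)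
  ; lead     = trans lead (sym (cₙ-odd j))
  ; trail    = trans trail (sym (dₙ-odd j)) }
  where open OddInvariant inv

toEven : ∀ {k n} j → n ≡ double (suc j) → Invariant k n → EvenInvariant k n j
toEven {k} j refl inv = record
  { degree   = trans degree (sₙ-even j)
  ; divPoly≋ = λ D → subst (ψᴰ D k (double (suc j)) ≋ᶜ_) (if-false (isOdd-double (+ 0) (+ 0) (suc j))) (divPoly≋ D)
  ; lead     = trans lead (cₙ-even j)
  ; trail    = trans trail (dₙ-even j) }
  where open Invariant inv

fromEven : ∀ {k n} j → n ≡ double (suc j) → EvenInvariant k n j → Invariant k n
fromEven {k} j refl inv = record
  { degree   = trans degree (sym (sₙ-even j))
  ; divPoly≋ = λ D → subst (ψᴰ D k (double (suc j)) ≋ᶜ_) (sym (if-false (isOdd-double (+ 0) (+ 0) (suc j)))) (divPoly≋ D)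
  ; lead     = trans lead (sym (cₙ-even j))
  ; trail    = trans trail (sym (dₙ-even j)) }
  where open EvenInvariant inv

invariant-1 : ∀ k → Invariant (suc k) 1
invariant-1 k = record { degree = refl ; divPoly≋ = λ D → ≋-refl , ≋-refl ; lead = refl ; trail = refl }

invariant-2 : ∀ k → Invariant (suc k) 2
invariant-2 k = record { degree = refl ; divPoly≋ = λ D → ≋-refl , ≋-refl ; lead = refl ; trail = refl }

invariant-3 : ∀ k → Invariant (suc k) 3
invariant-3 k = record { degree = refl ; divPoly≋ = λ D → divPoly₃ D , ≋-refl ; lead = refl ; trail = refl }

invariant-4 : ∀ k → Invariant (suc k) 4
invariant-4 k = record { degree = refl ; divPoly≋ = λ D → ≋-refl , divPoly₄ D ; lead = refl ; trail = refl }

InvariantBelow : ℕ → Set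
InvariantBelow k = ∀ i → 1 ≤ i → i ≤ k → Invariant k i

-- All indices used by the step at 2m or 2m + 1 are at most m + 2.
module Neighbours {k} (ih : InvariantBelow k) (m : ℕ) (bound : m ℕ.+ 2 ≤ k) where

  at : ∀ i → 1 ≤ i → i ≤ m ℕ.+ 2 → Invariant k i
  at i 1≤i i≤m+2 = ih i 1≤i (ℕP.≤-trans i≤m+2 bound)

  m≤m+2 : m ≤ m ℕ.+ 2
  m≤m+2 = ℕP.m≤m+n m 2

  m+1≤m+2 : m ℕ.+ 1 ≤ m ℕ.+ 2
  m+1≤m+2 = ℕP.+-monoʳ-≤ m (s≤s z≤n)

  m∸_≤m+2 : ∀ i → m ∸ i ≤ m ℕ.+ 2
  m∸ i ≤m+2 = ℕP.≤-trans (ℕP.m∸n≤m m i) m≤m+2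

odd-bound : ∀ m {k} → 2 ≤ m → suc (double m) ≤ suc k → m ℕ.+ 2 ≤ k
odd-bound m {k} 2≤m (s≤s 2m≤k) = ℕP.≤-trans (ℕP.+-monoʳ-≤ m 2≤m) (subst (_≤ k) (double≡+ m) 2m≤k)

even-bound : ∀ m {k} → 3 ≤ m → double m ≤ suc k → m ℕ.+ 2 ≤ k
even-bound m {k} 3≤m 2m≤1+k = ℕP.≤-pred (subst (_≤ suc k) (ℕP.+-suc m 2)
  (ℕP.≤-trans (ℕP.+-monoʳ-≤ m 3≤m) (subst (_≤ suc k) (double≡+ m) 2m≤1+k)))

-- The inductive step, by the residue of the index modulo 4

-- n = 2m + 1 with m = 2 (j + 1)
module OddIndexEvenMid (k j : ℕ) (ih : InvariantBelow k) (bound : double (suc j) ℕ.+ 2 ≤ k) where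
  open Neighbours ih (double (suc j)) bound

  m : ℕ
  m = double (suc j)
  A B C G : Homog
  A = f′ k (m ℕ.+ 2)
  B = f′ k m
  C = f′ k (m ∸ 1)
  G = f′ k (m ℕ.+ 1)

  hA : EvenInvariant k (m ℕ.+ 2) (suc j)
  hA = toEven (suc j) (ℕP.+-comm m 2) (at (m ℕ.+ 2) (s≤s z≤n) ℕP.≤-refl)
  hB : EvenInvariant k m j
  hB = toEven j refl (at m (s≤s z≤n) m≤m+2)
  hC : OddInvariant k (m ∸ 1) j
  hC = toOdd j refl (at (m ∸ 1) (s≤s z≤n) (m∸ 1 ≤m+2))
  hG : OddInvariant k (m ℕ.+ 1) (suc j)
  hG = toOdd (suc j) (ℕP.+-comm m 1) (at (m ℕ.+ 1) (s≤s z≤n) m+1≤m+2)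

  unfold : f′ (suc k) (suc (double m)) ≡ oddStepᵉ A B C G
  unfold = trans (f′-odd k m (s≤s (s≤s z≤n)))
                 (cong (λ step → step A B C G) (if-false {x = oddStepᵒ} {y = oddStepᵉ} (isOdd-double (+ 0) (+ 0) (suc j))))

  degrees : deg ((+ 16) ⊙ (Y⁴ · (A · B ³))) ≡ deg (C · G ³)
  degrees = trans (cong₂ (λ a b → 3 ℕ.+ (a ℕ.+ (b ℕ.+ (b ℕ.+ b)))) (Even.degree hA) (Even.degree hB))
           (trans (identity j) (sym (cong₂ (λ c g → c ℕ.+ (g ℕ.+ (g ℕ.+ g))) (Odd.degree hC) (Odd.degree hG))))
    where
    identity : ∀ j → let j₁ = 1 ℕ.+ j in
      3 ℕ.+ ((j₁ ℕ.* j₁ ℕ.+ 2 ℕ.* j₁) ℕ.+ ((j ℕ.* j ℕ.+ 2 ℕ.* j) ℕ.+ ((j ℕ.* j ℕ.+ 2 ℕ.* j) ℕ.+ (j ℕ.* j ℕ.+ 2 ℕ.* j))))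
      ≡ (j ℕ.* j ℕ.+ j) ℕ.+ ((j₁ ℕ.* j₁ ℕ.+ j₁) ℕ.+ ((j₁ ℕ.* j₁ ℕ.+ j₁) ℕ.+ (j₁ ℕ.* j₁ ℕ.+ j₁)))
    identity = ℕSolver.solve-∀

  invariant : OddInvariant (suc k) (suc (double m)) m
  invariant = record { degree = degree ; divPoly≋ = divPoly≋ ; lead = lead ; trail = trail }
    where
    degree : deg (f′ (suc k) (suc (double m))) ≡ m ℕ.* m ℕ.+ m
    degree = trans (cong deg unfold) (trans (deg-⊖ ((+ 16) ⊙ (Y⁴ · (A · B ³))) (C · G ³))
      (trans (cong₂ (λ c g → c ℕ.+ (g ℕ.+ (g ℕ.+ g))) (Odd.degree hC) (Odd.degree hG))
      (trans (identity j) (cong (λ x → x ℕ.* x ℕ.+ x) (sym (double≡+ (suc j)))))))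
      where
      identity : ∀ j → let j₁ = 1 ℕ.+ j in
        (j ℕ.* j ℕ.+ j) ℕ.+ ((j₁ ℕ.* j₁ ℕ.+ j₁) ℕ.+ ((j₁ ℕ.* j₁ ℕ.+ j₁) ℕ.+ (j₁ ℕ.* j₁ ℕ.+ j₁)))
        ≡ (j₁ ℕ.+ j₁) ℕ.* (j₁ ℕ.+ j₁) ℕ.+ (j₁ ℕ.+ j₁)
      identity = ℕSolver.solve-∀

    lead : Eval10.eval (f′ (suc k) (suc (double m))) ≡ + 1 ℤ.+ (+ m ℤ.+ + m)
    lead = trans (cong Eval10.eval unfold) (trans (Eval10.eval-oddStepᵉ A B C G degrees)
      (from-neighbours (Even.lead hA) (Even.lead hB) (Odd.lead hC) (Odd.lead hG)))
      where
      identity : ∀ J → let J₁ = + 1 ℤ.+ J ; G = + 1 ℤ.+ (J₁ ℤ.+ J₁) in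
        + 16 ℤ.* (+ 1 ℤ.* ((+ 1 ℤ.+ J₁) ℤ.* (J₁ ℤ.* (J₁ ℤ.* J₁)))) ℤ.- (+ 1 ℤ.+ (J ℤ.+ J)) ℤ.* (G ℤ.* (G ℤ.* G))
        ≡ + 1 ℤ.+ ((J₁ ℤ.+ J₁) ℤ.+ (J₁ ℤ.+ J₁))
      identity = ℤSolver.solve-∀
      from-neighbours : ∀ {a b c g} → a ≡ + 1 ℤ.+ + suc j → b ≡ + 1 ℤ.+ + j → c ≡ + 1 ℤ.+ (+ j ℤ.+ + j) →
        g ≡ + 1 ℤ.+ (+ suc j ℤ.+ + suc j) →
        + 16 ℤ.* (+ 1 ℤ.* (a ℤ.* (b ℤ.* (b ℤ.* b)))) ℤ.- c ℤ.* (g ℤ.* (g ℤ.* g)) ≡ + 1 ℤ.+ (+ m ℤ.+ + m)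
      from-neighbours refl refl refl refl =
        trans (identity (+ j)) (cong (λ x → + 1 ℤ.+ (x ℤ.+ x)) (sym (+double (suc j))))

    trail : Eval01.eval (f′ (suc k) (suc (double m))) ≡ (- (+ 1)) ℤ.^ m
    trail = trans (cong Eval01.eval unfold) (trans (Eval01.eval-oddStepᵉ A B C G degrees)
      (trans (from-neighbours (Odd.trail hC) (Odd.trail hG)) (sym (sign-double≡1 (suc j)))))
      where
      s = (- (+ 1)) ℤ.^ j
      identity : ∀ s w → + 16 ℤ.* (+ 0 ℤ.* w) ℤ.- s ℤ.* ((- (+ 1) ℤ.* s) ℤ.* ((- (+ 1) ℤ.* s) ℤ.* (- (+ 1) ℤ.* s)))
                         ≡ (s ℤ.* s) ℤ.* (s ℤ.* s)
      identity = ℤSolver.solve-∀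
      from-neighbours : ∀ {c g} → c ≡ s → g ≡ (- (+ 1)) ℤ.* s →
        + 16 ℤ.* (+ 0 ℤ.* (Eval01.eval A ℤ.* (Eval01.eval B ℤ.* (Eval01.eval B ℤ.* Eval01.eval B))))
          ℤ.- c ℤ.* (g ℤ.* (g ℤ.* g)) ≡ + 1
      from-neighbours refl refl =
        trans (identity s (Eval01.eval A ℤ.* (Eval01.eval B ℤ.* (Eval01.eval B ℤ.* Eval01.eval B))))
              (cong₂ ℤ._*_ (sign²≡1 j) (sign²≡1 j))

    divPoly≋ : ∀ D → ψᴰ D (suc k) (suc (double m)) ≋ᶜ oddForm (EvalCurve.eval D (f′ (suc k) (suc (double m))))
    divPoly≋ D = subst₂ _≋ᶜ_ (sym (ψ′-odd k m (s≤s (s≤s z≤n)))) (cong (oddForm ∘ EvalCurve.eval D) (sym unfold))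
      (≋ᶜ-trans (ψ-oddStep-evenMid (ψ′ k) m (Even.divPoly≋ hA D) (Even.divPoly≋ hB D) (Odd.divPoly≋ hC D) (Odd.divPoly≋ hG D))
                (oddForm-cong (≋-trans
                  (+ₚ-congʳ (negₚ (c *ₚ (g *ₚ (g *ₚ g)))) (*ₚ-congʳ (constₚ (+ 16)) (*ₚ-congˡ (a *ₚ (b *ₚ (b *ₚ b))) (cubic²≋eval-Y⁴ D))))
                  (≋-sym (EvalCurve.eval-oddStepᵉ D A B C G degrees)))))
      where
      open Recurrence (- D) (+ 0)
      open Curve (- D) (+ 0) using (ψ′)
      open EvalCurve D using (eval)
      a = eval A ; b = eval B ; c = eval C ; g = eval G

-- n = 2m + 1 with m = 2 (j + 1) + 1
module OddIndexOddMid (k j : ℕ) (ih : InvariantBelow k) (bound : suc (double (suc j)) ℕ.+ 2 ≤ k) where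
  open Neighbours ih (suc (double (suc j))) bound

  m : ℕ
  m = suc (double (suc j))
  A B C G : Homog
  A = f′ k (m ℕ.+ 2)
  B = f′ k m
  C = f′ k (m ∸ 1)
  G = f′ k (m ℕ.+ 1)

  hA : OddInvariant k (m ℕ.+ 2) (suc (suc j))
  hA = toOdd (suc (suc j)) (ℕP.+-comm m 2) (at (m ℕ.+ 2) (s≤s z≤n) ℕP.≤-refl)
  hB : OddInvariant k m (suc j)
  hB = toOdd (suc j) refl (at m (s≤s z≤n) m≤m+2)
  hC : EvenInvariant k (m ∸ 1) j
  hC = toEven j refl (at (m ∸ 1) (s≤s z≤n) (m∸ 1 ≤m+2))
  hG : EvenInvariant k (m ℕ.+ 1) (suc j)
  hG = toEven (suc j) (ℕP.+-comm m 1) (at (m ℕ.+ 1) (s≤s z≤n) m+1≤m+2)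

  unfold : f′ (suc k) (suc (double m)) ≡ oddStepᵒ A B C G
  unfold = trans (f′-odd k m (s≤s (s≤s z≤n)))
                 (cong (λ step → step A B C G) (if-true {x = oddStepᵒ} {y = oddStepᵉ} (isOdd-suc-double (+ 0) (+ 0) (suc j))))

  degrees : deg (A · B ³) ≡ deg ((+ 16) ⊙ (Y⁴ · (C · G ³)))
  degrees = trans (cong₂ (λ a b → a ℕ.+ (b ℕ.+ (b ℕ.+ b))) (Odd.degree hA) (Odd.degree hB))
           (trans (identity j) (sym (cong₂ (λ c g → 3 ℕ.+ (c ℕ.+ (g ℕ.+ (g ℕ.+ g)))) (Even.degree hC) (Even.degree hG))))
    where
    identity : ∀ j → let j₁ = 1 ℕ.+ j ; j₂ = 2 ℕ.+ j in
      (j₂ ℕ.* j₂ ℕ.+ j₂) ℕ.+ ((j₁ ℕ.* j₁ ℕ.+ j₁) ℕ.+ ((j₁ ℕ.* j₁ ℕ.+ j₁) ℕ.+ (j₁ ℕ.* j₁ ℕ.+ j₁)))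
      ≡ 3 ℕ.+ ((j ℕ.* j ℕ.+ 2 ℕ.* j) ℕ.+ ((j₁ ℕ.* j₁ ℕ.+ 2 ℕ.* j₁) ℕ.+ ((j₁ ℕ.* j₁ ℕ.+ 2 ℕ.* j₁) ℕ.+ (j₁ ℕ.* j₁ ℕ.+ 2 ℕ.* j₁))))
    identity = ℕSolver.solve-∀

  invariant : OddInvariant (suc k) (suc (double m)) m
  invariant = record { degree = degree ; divPoly≋ = divPoly≋ ; lead = lead ; trail = trail }
    where
    degree : deg (f′ (suc k) (suc (double m))) ≡ m ℕ.* m ℕ.+ m
    degree = trans (cong deg unfold) (trans (deg-⊖ (A · B ³) ((+ 16) ⊙ (Y⁴ · (C · G ³))))
      (trans (cong₂ (λ c g → 3 ℕ.+ (c ℕ.+ (g ℕ.+ (g ℕ.+ g)))) (Even.degree hC) (Even.degree hG))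
      (trans (identity j) (cong (λ x → suc x ℕ.* suc x ℕ.+ suc x) (sym (double≡+ (suc j)))))))
      where
      identity : ∀ j → let j₁ = 1 ℕ.+ j ; m = 1 ℕ.+ (j₁ ℕ.+ j₁) in
        3 ℕ.+ ((j ℕ.* j ℕ.+ 2 ℕ.* j) ℕ.+ ((j₁ ℕ.* j₁ ℕ.+ 2 ℕ.* j₁) ℕ.+ ((j₁ ℕ.* j₁ ℕ.+ 2 ℕ.* j₁) ℕ.+ (j₁ ℕ.* j₁ ℕ.+ 2 ℕ.* j₁))))
        ≡ m ℕ.* m ℕ.+ m
      identity = ℕSolver.solve-∀

    lead : Eval10.eval (f′ (suc k) (suc (double m))) ≡ + 1 ℤ.+ (+ m ℤ.+ + m)
    lead = trans (cong Eval10.eval unfold) (trans (Eval10.eval-oddStepᵒ A B C G degrees)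
      (from-neighbours (Odd.lead hA) (Odd.lead hB) (Even.lead hC) (Even.lead hG)))
      where
      identity : ∀ J → let J₁ = + 1 ℤ.+ J ; J₂ = + 1 ℤ.+ J₁ ; A = + 1 ℤ.+ (J₂ ℤ.+ J₂) ; B = + 1 ℤ.+ (J₁ ℤ.+ J₁) in
        A ℤ.* (B ℤ.* (B ℤ.* B)) ℤ.- + 16 ℤ.* (+ 1 ℤ.* ((+ 1 ℤ.+ J) ℤ.* (J₂ ℤ.* (J₂ ℤ.* J₂))))
        ≡ + 1 ℤ.+ (B ℤ.+ B)
      identity = ℤSolver.solve-∀
      +m : + m ≡ + 1 ℤ.+ (+ suc j ℤ.+ + suc j)
      +m = cong (λ x → + 1 ℤ.+ x) (+double (suc j))
      from-neighbours : ∀ {a b c g} → a ≡ + 1 ℤ.+ (+ suc (suc j) ℤ.+ + suc (suc j)) →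
        b ≡ + 1 ℤ.+ (+ suc j ℤ.+ + suc j) → c ≡ + 1 ℤ.+ + j → g ≡ + 1 ℤ.+ + suc j →
        a ℤ.* (b ℤ.* (b ℤ.* b)) ℤ.- + 16 ℤ.* (+ 1 ℤ.* (c ℤ.* (g ℤ.* (g ℤ.* g)))) ≡ + 1 ℤ.+ (+ m ℤ.+ + m)
      from-neighbours refl refl refl refl =
        trans (identity (+ j)) (cong (λ x → + 1 ℤ.+ (x ℤ.+ x)) (sym +m))

    trail : Eval01.eval (f′ (suc k) (suc (double m))) ≡ (- (+ 1)) ℤ.^ m
    trail = trans (cong Eval01.eval unfold) (trans (Eval01.eval-oddStepᵒ A B C G degrees)
      (trans (from-neighbours (Odd.trail hA) (Odd.trail hB)) (sym (cong ((- (+ 1)) ℤ.*_) (sign-double≡1 (suc j))))))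
      where
      s = (- (+ 1)) ℤ.^ j
      w = Eval01.eval C ℤ.* (Eval01.eval G ℤ.* (Eval01.eval G ℤ.* Eval01.eval G))
      identity : ∀ s w → let s₁ = - (+ 1) ℤ.* s ; s₂ = - (+ 1) ℤ.* s₁ in
        s₂ ℤ.* (s₁ ℤ.* (s₁ ℤ.* s₁)) ℤ.- + 16 ℤ.* (+ 0 ℤ.* w) ≡ - (+ 1) ℤ.* ((s ℤ.* s) ℤ.* (s ℤ.* s))
      identity = ℤSolver.solve-∀
      from-neighbours : ∀ {a b} → a ≡ (- (+ 1)) ℤ.* ((- (+ 1)) ℤ.* s) → b ≡ (- (+ 1)) ℤ.* s →
        a ℤ.* (b ℤ.* (b ℤ.* b)) ℤ.- + 16 ℤ.* (+ 0 ℤ.* w) ≡ - (+ 1) ℤ.* + 1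
      from-neighbours refl refl = trans (identity s w) (cong ((- (+ 1)) ℤ.*_) (cong₂ ℤ._*_ (sign²≡1 j) (sign²≡1 j)))

    divPoly≋ : ∀ D → ψᴰ D (suc k) (suc (double m)) ≋ᶜ oddForm (EvalCurve.eval D (f′ (suc k) (suc (double m))))
    divPoly≋ D = subst₂ _≋ᶜ_ (sym (ψ′-odd k m (s≤s (s≤s z≤n)))) (cong (oddForm ∘ EvalCurve.eval D) (sym unfold))
      (≋ᶜ-trans (ψ-oddStep-oddMid (ψ′ k) m (Odd.divPoly≋ hA D) (Odd.divPoly≋ hB D) (Even.divPoly≋ hC D) (Even.divPoly≋ hG D))
                (oddForm-cong (≋-trans
                  (+ₚ-congˡ (a *ₚ (b *ₚ (b *ₚ b)))
                    (negₚ-cong (*ₚ-congʳ (constₚ (+ 16)) (*ₚ-congˡ (c *ₚ (g *ₚ (g *ₚ g))) (cubic²≋eval-Y⁴ D)))))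
                  (≋-sym (EvalCurve.eval-oddStepᵒ D A B C G degrees)))))
      where
      open Recurrence (- D) (+ 0)
      open Curve (- D) (+ 0) using (ψ′)
      open EvalCurve D using (eval)
      a = eval A ; b = eval B ; c = eval C ; g = eval G

-- n = 2m with m = 2 (j + 2)
module EvenIndexEvenMid (k j : ℕ) (ih : InvariantBelow k) (bound : double (suc (suc j)) ℕ.+ 2 ≤ k) where
  open Neighbours ih (double (suc (suc j))) bound

  m : ℕ
  m = double (suc (suc j))
  M A C E G : Homog
  M = f′ k m
  A = f′ k (m ℕ.+ 2)
  C = f′ k (m ∸ 1)
  E = f′ k (m ∸ 2)
  G = f′ k (m ℕ.+ 1)

  hM : EvenInvariant k m (suc j)
  hM = toEven (suc j) refl (at m (s≤s z≤n) m≤m+2)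
  hA : EvenInvariant k (m ℕ.+ 2) (suc (suc j))
  hA = toEven (suc (suc j)) (ℕP.+-comm m 2) (at (m ℕ.+ 2) (s≤s z≤n) ℕP.≤-refl)
  hC : OddInvariant k (m ∸ 1) (suc j)
  hC = toOdd (suc j) refl (at (m ∸ 1) (s≤s z≤n) (m∸ 1 ≤m+2))
  hE : EvenInvariant k (m ∸ 2) j
  hE = toEven j refl (at (m ∸ 2) (s≤s z≤n) (m∸ 2 ≤m+2))
  hG : OddInvariant k (m ℕ.+ 1) (suc (suc j))
  hG = toOdd (suc (suc j)) (ℕP.+-comm m 1) (at (m ℕ.+ 1) (s≤s z≤n) m+1≤m+2)

  unfold : f′ (suc k) (double m) ≡ evenStep M A C E G
  unfold = f′-even k m (s≤s (s≤s (s≤s z≤n)))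

  degrees : deg (A · C ²) ≡ deg (E · G ²)
  degrees = trans (cong₂ (λ a c → a ℕ.+ (c ℕ.+ c)) (Even.degree hA) (Odd.degree hC))
           (trans (identity j) (sym (cong₂ (λ e g → e ℕ.+ (g ℕ.+ g)) (Even.degree hE) (Odd.degree hG))))
    where
    identity : ∀ j → let j₁ = 1 ℕ.+ j ; j₂ = 2 ℕ.+ j in
      (j₂ ℕ.* j₂ ℕ.+ 2 ℕ.* j₂) ℕ.+ ((j₁ ℕ.* j₁ ℕ.+ j₁) ℕ.+ (j₁ ℕ.* j₁ ℕ.+ j₁))
      ≡ (j ℕ.* j ℕ.+ 2 ℕ.* j) ℕ.+ ((j₂ ℕ.* j₂ ℕ.+ j₂) ℕ.+ (j₂ ℕ.* j₂ ℕ.+ j₂))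
    identity = ℕSolver.solve-∀

  j′ : ℕ
  j′ = suc (double (suc j))

  invariant : EvenInvariant (suc k) (double m) j′
  invariant = record { degree = degree ; divPoly≋ = divPoly≋ ; lead = lead ; trail = trail }
    where
    +j′ : + j′ ≡ + 1 ℤ.+ (+ suc j ℤ.+ + suc j)
    +j′ = cong (λ x → + 1 ℤ.+ x) (+double (suc j))

    degree : deg (f′ (suc k) (double m)) ≡ j′ ℕ.* j′ ℕ.+ 2 ℕ.* j′
    degree = trans (cong deg unfold) (trans (cong (deg M ℕ.+_) (deg-⊖ (A · C ²) (E · G ²)))
      (trans (cong₂ ℕ._+_ (Even.degree hM) (cong₂ (λ e g → e ℕ.+ (g ℕ.+ g)) (Even.degree hE) (Odd.degree hG)))
      (trans (identity j) (cong (λ x → suc x ℕ.* suc x ℕ.+ 2 ℕ.* suc x) (sym (double≡+ (suc j)))))))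
      where
      identity : ∀ j → let j₁ = 1 ℕ.+ j ; j₂ = 2 ℕ.+ j ; j′ = 1 ℕ.+ (j₁ ℕ.+ j₁) in
        (j₁ ℕ.* j₁ ℕ.+ 2 ℕ.* j₁) ℕ.+ ((j ℕ.* j ℕ.+ 2 ℕ.* j) ℕ.+ ((j₂ ℕ.* j₂ ℕ.+ j₂) ℕ.+ (j₂ ℕ.* j₂ ℕ.+ j₂)))
        ≡ j′ ℕ.* j′ ℕ.+ 2 ℕ.* j′
      identity = ℕSolver.solve-∀

    lead : Eval10.eval (f′ (suc k) (double m)) ≡ + 1 ℤ.+ + j′
    lead = trans (cong Eval10.eval unfold) (trans (Eval10.eval-evenStep M A C E G degrees)
      (from-neighbours (Even.lead hM) (Even.lead hA) (Odd.lead hC) (Even.lead hE) (Odd.lead hG)))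
      where
      identity : ∀ J → let J₁ = + 1 ℤ.+ J ; J₂ = + 1 ℤ.+ J₁ ; C = + 1 ℤ.+ (J₁ ℤ.+ J₁) ; G = + 1 ℤ.+ (J₂ ℤ.+ J₂) in
        (+ 1 ℤ.+ J₁) ℤ.* ((+ 1 ℤ.+ J₂) ℤ.* (C ℤ.* C) ℤ.- (+ 1 ℤ.+ J) ℤ.* (G ℤ.* G)) ≡ + 1 ℤ.+ C
      identity = ℤSolver.solve-∀
      from-neighbours : ∀ {μ a c e g} → μ ≡ + 1 ℤ.+ + suc j → a ≡ + 1 ℤ.+ + suc (suc j) →
        c ≡ + 1 ℤ.+ (+ suc j ℤ.+ + suc j) → e ≡ + 1 ℤ.+ + j → g ≡ + 1 ℤ.+ (+ suc (suc j) ℤ.+ + suc (suc j)) →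
        μ ℤ.* (a ℤ.* (c ℤ.* c) ℤ.- e ℤ.* (g ℤ.* g)) ≡ + 1 ℤ.+ + j′
      from-neighbours refl refl refl refl refl = trans (identity (+ j)) (cong (λ x → + 1 ℤ.+ x) (sym +j′))

    trail : Eval01.eval (f′ (suc k) (double m)) ≡ + 1 ℤ.+ + j′
    trail = trans (cong Eval01.eval unfold) (trans (Eval01.eval-evenStep M A C E G degrees)
      (from-neighbours (Even.trail hM) (Even.trail hA) (Odd.trail hC) (Even.trail hE) (Odd.trail hG)))
      where
      s = (- (+ 1)) ℤ.^ j
      signs-squared : ∀ J s → let s₁ = - (+ 1) ℤ.* s ; s₂ = - (+ 1) ℤ.* s₁ in
        (+ 2 ℤ.+ J) ℤ.* ((+ 3 ℤ.+ J) ℤ.* (s₁ ℤ.* s₁) ℤ.- (+ 1 ℤ.+ J) ℤ.* (s₂ ℤ.* s₂))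
        ≡ (+ 2 ℤ.+ J) ℤ.* ((+ 3 ℤ.+ J) ℤ.* (s ℤ.* s) ℤ.- (+ 1 ℤ.+ J) ℤ.* (s ℤ.* s))
      signs-squared = ℤSolver.solve-∀
      identity : ∀ J → (+ 2 ℤ.+ J) ℤ.* ((+ 3 ℤ.+ J) ℤ.* + 1 ℤ.- (+ 1 ℤ.+ J) ℤ.* + 1) ≡ + 1 ℤ.+ (+ 1 ℤ.+ ((+ 1 ℤ.+ J) ℤ.+ (+ 1 ℤ.+ J)))
      identity = ℤSolver.solve-∀
      from-neighbours : ∀ {μ a c e g} → μ ≡ + 1 ℤ.+ + suc j → a ≡ + 1 ℤ.+ + suc (suc j) →
        c ≡ (- (+ 1)) ℤ.* s → e ≡ + 1 ℤ.+ + j → g ≡ (- (+ 1)) ℤ.* ((- (+ 1)) ℤ.* s) →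
        μ ℤ.* (a ℤ.* (c ℤ.* c) ℤ.- e ℤ.* (g ℤ.* g)) ≡ + 1 ℤ.+ + j′
      from-neighbours refl refl refl refl refl = begin
        _  ≡⟨ signs-squared (+ j) s ⟩
        _  ≡⟨ cong (λ t → (+ 2 ℤ.+ + j) ℤ.* ((+ 3 ℤ.+ + j) ℤ.* t ℤ.- (+ 1 ℤ.+ + j) ℤ.* t)) (sign²≡1 j) ⟩
        _  ≡⟨ identity (+ j) ⟩
        _  ≡⟨ cong (λ x → + 1 ℤ.+ x) (sym +j′) ⟩
        + 1 ℤ.+ + j′ ∎
        where open Eq.≡-Reasoning

    divPoly≋ : ∀ D → ψᴰ D (suc k) (double m) ≋ᶜ evenForm (EvalCurve.eval D (f′ (suc k) (double m)))
    divPoly≋ D = subst₂ _≋ᶜ_ (sym (ψ′-even k m (s≤s (s≤s (s≤s z≤n))))) (cong (evenForm ∘ EvalCurve.eval D) (sym unfold))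
      (≋ᶜ-trans (ψ-evenStep-evenMid (ψ′ k) m (Even.divPoly≋ hM D) (Even.divPoly≋ hA D) (Odd.divPoly≋ hC D)
                                             (Even.divPoly≋ hE D) (Odd.divPoly≋ hG D))
                (evenForm-cong (≋-sym (EvalCurve.eval-evenStep D M A C E G degrees))))
      where
      open Recurrence (- D) (+ 0)
      open Curve (- D) (+ 0) using (ψ′)

-- n = 2m with m = 2 (j + 1) + 1
module EvenIndexOddMid (k j : ℕ) (ih : InvariantBelow k) (bound : suc (double (suc j)) ℕ.+ 2 ≤ k) where
  open Neighbours ih (suc (double (suc j))) bound

  m : ℕ
  m = suc (double (suc j))
  M A C E G : Homog
  M = f′ k m
  A = f′ k (m ℕ.+ 2)
  C = f′ k (m ∸ 1)
  E = f′ k (m ∸ 2)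
  G = f′ k (m ℕ.+ 1)

  hM : OddInvariant k m (suc j)
  hM = toOdd (suc j) refl (at m (s≤s z≤n) m≤m+2)
  hA : OddInvariant k (m ℕ.+ 2) (suc (suc j))
  hA = toOdd (suc (suc j)) (ℕP.+-comm m 2) (at (m ℕ.+ 2) (s≤s z≤n) ℕP.≤-refl)
  hC : EvenInvariant k (m ∸ 1) j
  hC = toEven j refl (at (m ∸ 1) (s≤s z≤n) (m∸ 1 ≤m+2))
  hE : OddInvariant k (m ∸ 2) j
  hE = toOdd j refl (at (m ∸ 2) (s≤s z≤n) (m∸ 2 ≤m+2))
  hG : EvenInvariant k (m ℕ.+ 1) (suc j)
  hG = toEven (suc j) (ℕP.+-comm m 1) (at (m ℕ.+ 1) (s≤s z≤n) m+1≤m+2)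

  unfold : f′ (suc k) (double m) ≡ evenStep M A C E G
  unfold = f′-even k m (s≤s (s≤s (s≤s z≤n)))

  degrees : deg (A · C ²) ≡ deg (E · G ²)
  degrees = trans (cong₂ (λ a c → a ℕ.+ (c ℕ.+ c)) (Odd.degree hA) (Even.degree hC))
           (trans (identity j) (sym (cong₂ (λ e g → e ℕ.+ (g ℕ.+ g)) (Odd.degree hE) (Even.degree hG))))
    where
    identity : ∀ j → let j₁ = 1 ℕ.+ j ; j₂ = 2 ℕ.+ j in
      (j₂ ℕ.* j₂ ℕ.+ j₂) ℕ.+ ((j ℕ.* j ℕ.+ 2 ℕ.* j) ℕ.+ (j ℕ.* j ℕ.+ 2 ℕ.* j))
      ≡ (j ℕ.* j ℕ.+ j) ℕ.+ ((j₁ ℕ.* j₁ ℕ.+ 2 ℕ.* j₁) ℕ.+ (j₁ ℕ.* j₁ ℕ.+ 2 ℕ.* j₁))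
    identity = ℕSolver.solve-∀

  j′ : ℕ
  j′ = double (suc j)

  invariant : EvenInvariant (suc k) (double m) j′
  invariant = record { degree = degree ; divPoly≋ = divPoly≋ ; lead = lead ; trail = trail }
    where
    +j′ : + j′ ≡ + suc j ℤ.+ + suc j
    +j′ = +double (suc j)

    degree : deg (f′ (suc k) (double m)) ≡ j′ ℕ.* j′ ℕ.+ 2 ℕ.* j′
    degree = trans (cong deg unfold) (trans (cong (deg M ℕ.+_) (deg-⊖ (A · C ²) (E · G ²)))
      (trans (cong₂ ℕ._+_ (Odd.degree hM) (cong₂ (λ e g → e ℕ.+ (g ℕ.+ g)) (Odd.degree hE) (Even.degree hG)))
      (trans (identity j) (cong (λ x → x ℕ.* x ℕ.+ 2 ℕ.* x) (sym (double≡+ (suc j)))))))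
      where
      identity : ∀ j → let j₁ = 1 ℕ.+ j ; j′ = j₁ ℕ.+ j₁ in
        (j₁ ℕ.* j₁ ℕ.+ j₁) ℕ.+ ((j ℕ.* j ℕ.+ j) ℕ.+ ((j₁ ℕ.* j₁ ℕ.+ 2 ℕ.* j₁) ℕ.+ (j₁ ℕ.* j₁ ℕ.+ 2 ℕ.* j₁)))
        ≡ j′ ℕ.* j′ ℕ.+ 2 ℕ.* j′
      identity = ℕSolver.solve-∀

    lead : Eval10.eval (f′ (suc k) (double m)) ≡ + 1 ℤ.+ + j′
    lead = trans (cong Eval10.eval unfold) (trans (Eval10.eval-evenStep M A C E G degrees)
      (from-neighbours (Odd.lead hM) (Odd.lead hA) (Even.lead hC) (Odd.lead hE) (Even.lead hG)))
      where
      identity : ∀ J → let J₁ = + 1 ℤ.+ J ; J₂ = + 1 ℤ.+ J₁ in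
        (+ 1 ℤ.+ (J₁ ℤ.+ J₁)) ℤ.* ((+ 1 ℤ.+ (J₂ ℤ.+ J₂)) ℤ.* ((+ 1 ℤ.+ J) ℤ.* (+ 1 ℤ.+ J))
          ℤ.- (+ 1 ℤ.+ (J ℤ.+ J)) ℤ.* (J₂ ℤ.* J₂))
        ≡ + 1 ℤ.+ (J₁ ℤ.+ J₁)
      identity = ℤSolver.solve-∀
      from-neighbours : ∀ {μ a c e g} → μ ≡ + 1 ℤ.+ (+ suc j ℤ.+ + suc j) →
        a ≡ + 1 ℤ.+ (+ suc (suc j) ℤ.+ + suc (suc j)) → c ≡ + 1 ℤ.+ + j → e ≡ + 1 ℤ.+ (+ j ℤ.+ + j) →
        g ≡ + 1 ℤ.+ + suc j →
        μ ℤ.* (a ℤ.* (c ℤ.* c) ℤ.- e ℤ.* (g ℤ.* g)) ≡ + 1 ℤ.+ + j′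
      from-neighbours refl refl refl refl refl = trans (identity (+ j)) (cong (λ x → + 1 ℤ.+ x) (sym +j′))

    trail : Eval01.eval (f′ (suc k) (double m)) ≡ + 1 ℤ.+ + j′
    trail = trans (cong Eval01.eval unfold) (trans (Eval01.eval-evenStep M A C E G degrees)
      (from-neighbours (Odd.trail hM) (Odd.trail hA) (Even.trail hC) (Odd.trail hE) (Even.trail hG)))
      where
      s = (- (+ 1)) ℤ.^ j
      signs-squared : ∀ J s → let s₁ = - (+ 1) ℤ.* s ; s₂ = - (+ 1) ℤ.* s₁ in
        s₁ ℤ.* (s₂ ℤ.* ((+ 1 ℤ.+ J) ℤ.* (+ 1 ℤ.+ J)) ℤ.- s ℤ.* ((+ 2 ℤ.+ J) ℤ.* (+ 2 ℤ.+ J)))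
        ≡ (s ℤ.* s) ℤ.* ((+ 2 ℤ.+ J) ℤ.* (+ 2 ℤ.+ J) ℤ.- (+ 1 ℤ.+ J) ℤ.* (+ 1 ℤ.+ J))
      signs-squared = ℤSolver.solve-∀
      identity : ∀ J → + 1 ℤ.* ((+ 2 ℤ.+ J) ℤ.* (+ 2 ℤ.+ J) ℤ.- (+ 1 ℤ.+ J) ℤ.* (+ 1 ℤ.+ J))
                       ≡ + 1 ℤ.+ ((+ 1 ℤ.+ J) ℤ.+ (+ 1 ℤ.+ J))
      identity = ℤSolver.solve-∀
      from-neighbours : ∀ {μ a c e g} → μ ≡ (- (+ 1)) ℤ.* s → a ≡ (- (+ 1)) ℤ.* ((- (+ 1)) ℤ.* s) →
        c ≡ + 1 ℤ.+ + j → e ≡ s → g ≡ + 1 ℤ.+ + suc j →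
        μ ℤ.* (a ℤ.* (c ℤ.* c) ℤ.- e ℤ.* (g ℤ.* g)) ≡ + 1 ℤ.+ + j′
      from-neighbours refl refl refl refl refl = begin
        _  ≡⟨ signs-squared (+ j) s ⟩
        _  ≡⟨ cong (λ t → t ℤ.* ((+ 2 ℤ.+ + j) ℤ.* (+ 2 ℤ.+ + j) ℤ.- (+ 1 ℤ.+ + j) ℤ.* (+ 1 ℤ.+ + j))) (sign²≡1 j) ⟩
        _  ≡⟨ identity (+ j) ⟩
        _  ≡⟨ cong (λ x → + 1 ℤ.+ x) (sym +j′) ⟩
        + 1 ℤ.+ + j′ ∎
        where open Eq.≡-Reasoning

    divPoly≋ : ∀ D → ψᴰ D (suc k) (double m) ≋ᶜ evenForm (EvalCurve.eval D (f′ (suc k) (double m)))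
    divPoly≋ D = subst₂ _≋ᶜ_ (sym (ψ′-even k m (s≤s (s≤s (s≤s z≤n))))) (cong (evenForm ∘ EvalCurve.eval D) (sym unfold))
      (≋ᶜ-trans (ψ-evenStep-oddMid (ψ′ k) m (Odd.divPoly≋ hM D) (Odd.divPoly≋ hA D) (Even.divPoly≋ hC D)
                                            (Odd.divPoly≋ hE D) (Even.divPoly≋ hG D))
                (evenForm-cong (≋-sym (EvalCurve.eval-evenStep D M A C E G degrees))))
      where
      open Recurrence (- D) (+ 0)
      open Curve (- D) (+ 0) using (ψ′)

data ResidueMod4 : ℕ → Set where
  odd-evenMid  : ∀ j → ResidueMod4 (suc (double (double (suc j))))
  odd-oddMid   : ∀ j → ResidueMod4 (suc (double (suc (double (suc j)))))
  even-evenMid : ∀ j → ResidueMod4 (double (double (suc (suc j))))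
  even-oddMid  : ∀ j → ResidueMod4 (double (suc (double (suc j))))

residueMod4 : ∀ r → ResidueMod4 (5 ℕ.+ r)
residueMod4 0 = odd-evenMid 0
residueMod4 1 = even-oddMid 0
residueMod4 2 = odd-oddMid 0
residueMod4 3 = even-evenMid 0
residueMod4 (suc (suc (suc (suc r)))) with residueMod4 r
... | odd-evenMid j  = odd-evenMid (suc j)
... | odd-oddMid j   = odd-oddMid (suc j)
... | even-evenMid j = even-evenMid (suc j)
... | even-oddMid j  = even-oddMid (suc j)

invariantBelow : ∀ k → InvariantBelow k
invariantBelow zero    (suc i) _ ()
invariantBelow (suc k) 1 _ _ = invariant-1 k
invariantBelow (suc k) 2 _ _ = invariant-2 k
invariantBelow (suc k) 3 _ _ = invariant-3 k
invariantBelow (suc k) 4 _ _ = invariant-4 k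
invariantBelow (suc k) (suc (suc (suc (suc (suc r))))) _ n≤1+k with residueMod4 r
... | odd-evenMid j  = fromOdd _ refl (OddIndexEvenMid.invariant k j (invariantBelow k) (odd-bound _ (s≤s (s≤s z≤n)) n≤1+k))
... | odd-oddMid j   = fromOdd _ refl (OddIndexOddMid.invariant k j (invariantBelow k) (odd-bound _ (s≤s (s≤s z≤n)) n≤1+k))
... | even-evenMid j = fromEven _ refl (EvenIndexEvenMid.invariant k j (invariantBelow k) (even-bound _ (s≤s (s≤s (s≤s z≤n))) n≤1+k))
... | even-oddMid j  = fromEven _ refl (EvenIndexOddMid.invariant k j (invariantBelow k) (even-bound _ (s≤s (s≤s (s≤s z≤n))) n≤1+k))

realise : ∀ n (F : Homog) → deg F ≡ sₙ n → Eval10.eval F ≡ cₙ n → Eval01.eval F ≡ dₙ n →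
  (∀ D → divPoly D n ≋ᶜ formOf n (EvalCurve.eval D F)) →
  Σ (HomPoly (sₙ n)) (λ f →
    (lookup f zero ≡ cₙ n) ×
    (lookup f (fromℕ (sₙ n)) ≡ dₙ n) ×
    ((D : ℤ) → D ≢ + 0 → divPoly D n ≈ᶜ shape n D f))
realise n (s , f) refl lead trail divPoly≋ =
  f , trans (lookup-first≡eval10 s f) lead , trans (lookup-last≡eval01 s f) trail , λ D _ →
  let (re≋ , im≋) = ≋ᶜ-trans (divPoly≋ D) (formOf-cong n (≋-sym (evalHom≋evalₕ (Xₚ ^ₚ 2) (constₚ D) s f)))
  in un re≋ , un im≋

lemma2p1 : (n : ℕ) → 1 ≤ n →
    Σ (HomPoly (sₙ n)) (λ f →
      (lookup f zero ≡ cₙ n) ×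
      (lookup f (fromℕ (sₙ n)) ≡ dₙ n) ×
      ((D : ℤ) → D ≢ + 0 → divPoly D n ≈ᶜ shape n D f))
lemma2p1 n 1≤n = realise n (f′ n n) degree lead trail divPoly≋
  where open Invariant (invariantBelow n n 1≤n ℕP.≤-refl)
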